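{- Let $n,k$ be integers with $1\le k<n/2$. If $A(n,k)\ne B(n,k)$, then $R_j=S_j=T_j$ for all $j\ge3$.
   Context: $\mathrm{DGP}(n,k)$ is the canonical double cover of the generalized Petersen graph $\mathrm{GP}(n,k)$: vertex set $\{(u_i,j),(v_i,j): 0\le i\le n-1, j\in\{0,1\}\}$, with outer edges $\{(u_i,j),(u_{i+1},1-j)\}$, inner edges $\{(v_i,j),(v_{i+k},1-j)\}$, and spokes $\{(u_i,j),(v_i,1-j)\}$ (subscripts mod $n$). $A(n,k)=\mathrm{Aut}(\mathrm{DGP}(n,k))$ and $B(n,k)$ is the setwise stabilizer in $A(n,k)$ of the set of spokes. For a cycle $C$, $r(C),s(C),t(C)$ denote the numbers of outer edges, spokes and inner edges of $C$. For $3\le j\le 4n$ let $\mathcal{C}_j$ be the set of $j$-cycles of $\mathrm{DGP}(n,k)$ and $R_j=\sum_{C\in\mathcal{C}_j}r(C)$, $S_j=\sum_{C\in\mathcal{C}_j}s(C)$, $T_j=\sum_{C\in\mathcal{C}_j}t(C)$. -}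

module Defs where

open import Data.Bool using (Bool; true; false; _∧_; _∨_; not; if_then_else_; T)
open import Data.Nat using (ℕ; zero; suc; _+_; _*_; _<ᵇ_; _≡ᵇ_; NonZero)
open import Data.Nat.DivMod using (_%_)
open import Data.Fin using (Fin; toℕ)
open import Data.Fin.Base using () renaming (zero to f0; suc to fs)
open import Data.List using (List; []; _∷_; [_]; _++_; map; concatMap; filter; length; allFin)
open import Data.Nat.ListAction using (sum)
open import Data.Product using (_×_; _,_; Σ; ∃)
open import Relation.Binary.PropositionalEquality using (_≡_)
open import Relation.Nullary using (¬_)
open import Function.Bundles using (_↔_; Inverse)

-- Vertices of DGP(n,k):  (u_i , j) is  vert false i j,  (v_i , j) is  vert true i j

record Vtx (n : ℕ) : Set where
  constructor vert
  field
    isInner : Bool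
    idx     : Fin n
    lay     : Fin 2
open Vtx public

allVtx : (n : ℕ) → List (Vtx n)
allVtx n = concatMap (λ b → concatMap (λ i → map (vert b i) (allFin 2)) (allFin n)) (true ∷ false ∷ [])

-- a numeric code (injective), used only to fix a total order on vertices
code : {n : ℕ} → Vtx n → ℕ
code {n} (vert b i l) = (if b then 2 * n else 0) + 2 * toℕ i + toℕ l

_==V_ : {n : ℕ} → Vtx n → Vtx n → Bool
x ==V y = code x ≡ᵇ code y

data EType : Set where
  outer spoke inner : EType

_==E_ : EType → EType → Bool
outer ==E outer = true
spoke ==E spoke = true
inner ==E inner = true
_ ==E _ = false

stepᵇ : (n : ℕ) .{{_ : NonZero n}} → ℕ → Fin n → Fin n → Bool
stepᵇ n s i i' = ((toℕ i + s) % n) ≡ᵇ toℕ i'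

flipᵇ : Fin 2 → Fin 2 → Bool
flipᵇ l l' = not (toℕ l ≡ᵇ toℕ l')

isEdgeOfType : (n k : ℕ) .{{_ : NonZero n}} → EType → Vtx n → Vtx n → Bool
isEdgeOfType n k outer (vert false i l) (vert false i' l') =
  flipᵇ l l' ∧ (stepᵇ n 1 i i' ∨ stepᵇ n 1 i' i)
isEdgeOfType n k inner (vert true i l) (vert true i' l') =
  flipᵇ l l' ∧ (stepᵇ n k i i' ∨ stepᵇ n k i' i)
isEdgeOfType n k spoke (vert false i l) (vert true i' l') =
  flipᵇ l l' ∧ (toℕ i ≡ᵇ toℕ i')
isEdgeOfType n k spoke (vert true i l) (vert false i' l') =
  flipᵇ l l' ∧ (toℕ i ≡ᵇ toℕ i')
isEdgeOfType n k _ _ _ = false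

adjᵇ : (n k : ℕ) .{{_ : NonZero n}} → Vtx n → Vtx n → Bool
adjᵇ n k x y = isEdgeOfType n k outer x y ∨ isEdgeOfType n k spoke x y ∨ isEdgeOfType n k inner x y

Adj : (n k : ℕ) .{{_ : NonZero n}} → Vtx n → Vtx n → Set
Adj n k x y = T (adjᵇ n k x y)

Spoke : (n k : ℕ) .{{_ : NonZero n}} → Vtx n → Vtx n → Set
Spoke n k x y = T (isEdgeOfType n k spoke x y)

record IsAut (n k : ℕ) .{{_ : NonZero n}} (σ : Vtx n ↔ Vtx n) : Set where
  open Inverse σ using (to)
  field
    preserves : ∀ x y → Adj n k x y → Adj n k (to x) (to y)
    reflects  : ∀ x y → Adj n k (to x) (to y) → Adj n k x y

record InB (n k : ℕ) .{{_ : NonZero n}} (σ : Vtx n ↔ Vtx n) : Set where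
  open Inverse σ using (to)
  field
    image⊆ : ∀ x y → Spoke n k x y → Spoke n k (to x) (to y)
    ⊆image : ∀ x y → Spoke n k x y →
             Σ (Vtx n) λ x' → Σ (Vtx n) λ y' → Spoke n k x' y' × (to x' ≡ x) × (to y' ≡ y)

-- A(n,k) ≠ B(n,k)  (B(n,k) ⊆ A(n,k) by definition, so this says some automorphism is not in B)
A≢B : (n k : ℕ) .{{_ : NonZero n}} → Set
A≢B n k = Σ (Vtx n ↔ Vtx n) λ σ → IsAut n k σ × ¬ InB n k σ

allSeqs : {A : Set} → List A → ℕ → List (List A)
allSeqs xs zero = [ [] ]
allSeqs xs (suc m) = concatMap (λ x → map (x ∷_) (allSeqs xs m)) xs

rotate : {A : Set} → List A → List A
rotate [] = []
rotate (x ∷ xs) = xs ++ [ x ]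

zipL : {A : Set} → List A → List A → List (A × A)
zipL (x ∷ xs) (y ∷ ys) = (x , y) ∷ zipL xs ys
zipL _ _ = []

cycEdges : {A : Set} → List A → List (A × A)
cycEdges w = zipL w (rotate w)

allᵇ : {A : Set} → (A → Bool) → List A → Bool
allᵇ p [] = true
allᵇ p (x ∷ xs) = p x ∧ allᵇ p xs

distinctᵇ : {n : ℕ} → List (Vtx n) → Bool
distinctᵇ [] = true
distinctᵇ (x ∷ xs) = allᵇ (λ y → not (x ==V y)) xs ∧ distinctᵇ xs

lastOr : {A : Set} → A → List A → A
lastOr d [] = d
lastOr d (x ∷ xs) = lastOr x xs

-- canonical representative of a cycle (as a cyclic vertex sequence up to rotation
-- and reversal): w0 has the smallest code, and code w1 < code w_{m-1}
canonicalᵇ : {n : ℕ} → List (Vtx n) → Bool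
canonicalᵇ [] = false
canonicalᵇ (x ∷ []) = false
canonicalᵇ (x ∷ y ∷ ys) =
  allᵇ (λ z → code x <ᵇ code z) (y ∷ ys) ∧ (code y <ᵇ code (lastOr y ys))

isCanonCycleᵇ : (n k : ℕ) .{{_ : NonZero n}} → List (Vtx n) → Bool
isCanonCycleᵇ n k w =
  distinctᵇ w ∧ allᵇ (λ p → adjᵇ n k (Data.Product.proj₁ p) (Data.Product.proj₂ p)) (cycEdges w)
              ∧ canonicalᵇ w

cycles : (n k : ℕ) .{{_ : NonZero n}} → ℕ → List (List (Vtx n))
cycles n k j = filter (λ w → T? (isCanonCycleᵇ n k w)) (allSeqs (allVtx n) j)
  where
  open import Relation.Nullary.Decidable using (Dec)
  open import Data.Bool.Properties using (T?)

countType : (n k : ℕ) .{{_ : NonZero n}} → EType → List (Vtx n) → ℕ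
countType n k e w =
  length (filter (λ p → T? (isEdgeOfType n k e (Data.Product.proj₁ p) (Data.Product.proj₂ p))) (cycEdges w))
  where open import Data.Bool.Properties using (T?)

sumType : (n k : ℕ) .{{_ : NonZero n}} → EType → ℕ → ℕ
sumType n k e j = sum (map (countType n k e) (cycles n k j))

R S T' : (n k : ℕ) .{{_ : NonZero n}} → ℕ → ℕ
R n k = sumType n k outer
S n k = sumType n k spoke
T' n k = sumType n k inner

-- For an edge p of DGP(n,k) let c(p) be the number of j-cycles through p. The rotations i ↦ i + s
-- and the exchange of the two layers are automorphisms acting transitively on the edges of each type,
-- so c takes one value c(e) on all edges of type e; since 2k < n each type has exactly 2n edges, and
-- R_j, S_j, T_j are 2n·c(outer), 2n·c(spoke), 2n·c(inner). An automorphism σ permutes the j-cycles,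
-- so c(σ p) = c(p) and σ sends edges of type e to edges of a type with the same count. If the three
-- counts are not all equal, one of them differs from the other two and σ preserves that type. If it is
-- the spoke type we are done; if it is the outer (inner) type, σ maps u-vertices to u-vertices
-- (v-vertices to v-vertices), and then a spoke, having one end of each kind and a count different
-- from that type, can only be mapped to a spoke. Either way σ ∈ B(n,k), contradicting A(n,k) ≠ B(n,k).

module Submission where

open import Defs
open import Data.Nat using (ℕ; _*_; _≤_; _<_; NonZero)
open import Data.Product using (_×_)
open import Relation.Binary.PropositionalEquality using (_≡_)

open import Data.Bool using (Bool; true; false; _∧_; _∨_; not; if_then_else_; T)
open import Data.Bool.Properties using (T?; T-∧; T-∨; T-≡; ∧-comm; ∨-comm)
open import Data.Empty using (⊥; ⊥-elim)
open import Data.Fin using (Fin; toℕ; combine) renaming (zero to 0F; suc to sucF)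
open import Data.Fin.Properties using (toℕ-combine; combine-injective; toℕ-injective; toℕ<n; toℕ-fromℕ<)
open import Data.List using (List; []; _∷_; [_]; _++_; _∷ʳ_; map; reverse; length; filter; concatMap; cartesianProductWith; cartesianProduct; allFin)
open import Data.List.Extrema.Nat using (argmin; argmin-sel; f[argmin]≤f[⊤]; f[argmin]≤f[xs])
open import Data.List.Membership.Propositional using (_∈_)
open import Data.List.Membership.Propositional.Properties using (∈-++⁺ˡ; ∈-++⁺ʳ; ∈-++⁻; ∈-∃++; ∈-allFin; ∈-map⁺; ∈-map⁻; ∈-cartesianProductWith⁺; ∈-cartesianProductWith⁻; ∈-cartesianProduct⁺; ∈-filter⁺; ∈-filter⁻)
open import Data.List.Membership.Propositional.Properties.WithK using (unique∧set⇒bag)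
open import Data.List.Properties using (++-assoc; ++-identityʳ; map-++; map-∘; map-cong; map-cong-local; length-map; reverse-++; reverse-involutive; reverse-map; unfold-reverse; ∷-injective)
open import Data.List.Relation.Binary.BagAndSetEquality using (∼bag⇒↭)
open import Data.List.Relation.Binary.Permutation.Propositional using (_↭_; ↭-refl; ↭-sym; ↭-trans; ↭-prep; ↭⇒↭ₛ)
import Data.List.Relation.Binary.Permutation.Propositional as ↭
open import Data.List.Relation.Binary.Permutation.Propositional.Properties using (∷↭∷ʳ; ↭-reverse; ↭-length; All-resp-↭; ++-comm) renaming (map⁺ to ↭-map⁺)
import Data.List.Relation.Binary.Permutation.Setoid.Properties as Permₛ
open import Data.List.Relation.Unary.All as All using (All; []; _∷_)
import Data.List.Relation.Unary.All.Properties as All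
open import Data.List.Relation.Unary.Any using (here; there)
open import Data.List.Relation.Unary.Unique.Propositional using (Unique; []; _∷_)
open import Data.List.Relation.Unary.Unique.Propositional.Properties using (++⁺; cartesianProductWith⁺; cartesianProduct⁺; allFin⁺; filter⁺) renaming (map⁺ to Unique-map⁺)
open import Data.Nat using (zero; suc; _+_; _∸_; _%_; _≡ᵇ_; _<ᵇ_; _<?_; _≟_; s≤s; z≤n; s≤s⁻¹)
open import Data.Nat.DivMod using (_mod_; %-distribˡ-+; m%n%n≡m%n; [m+n]%n≡m%n; m<n⇒m%n≡m; m≤n⇒[n∸m]%m≡n%m)
open import Data.Nat.ListAction using (sum)
open import Data.Nat.ListAction.Properties using (sum-↭)
open import Data.Nat.Properties using (≡ᵇ⇒≡; ≡⇒≡ᵇ; <ᵇ⇒<; <⇒<ᵇ; ≤-refl; <⇒≤; ≤-antisym; ≤∧≢⇒<; <-asym; ≮⇒≥; <⇒≢; ≤-<-trans; <-≤-trans; m≤m+n; m<m+n; m+n≮m; +-identityʳ; +-assoc; +-comm; +-cancelˡ-≡; *-comm; *-monoʳ-≤; m∸n+n≡m; m+[n∸m]≡n; m+n∸n≡m; +-mono-<; ∸-monoˡ-<; +-commutativeSemigroup)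
open import Data.Product using (_,_; proj₁; proj₂; Σ; ∃; swap)
import Data.Product as ×
open import Data.Sum using (_⊎_; inj₁; inj₂)
open import Function using (_∘_; _⇔_; mk⇔; Equivalence; _↔_; mk↔ₛ′; Inverse)
open import Function.Construct.Symmetry using (↔-sym)
open import Relation.Binary.PropositionalEquality using (_≢_; _≗_; refl; sym; trans; cong; cong₂; subst; subst₂; setoid; module ≡-Reasoning)
open import Relation.Nullary using (¬_; yes; no)
open import Relation.Nullary.Decidable using (_×-dec_)
open import Algebra.Properties.CommutativeSemigroup +-commutativeSemigroup using (interchange)

open Equivalence using (to; from)

private variable
  A B C : Set

T-injective : {a b : Bool} → T a ⇔ T b → a ≡ b
T-injective {true} {true} _ = refl
T-injective {true} {false} a⇔b with () ← to a⇔b _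
T-injective {false} {true} a⇔b with () ← from a⇔b _
T-injective {false} {false} _ = refl

𝟙 : Bool → ℕ
𝟙 true = 1
𝟙 false = 0

∑ : List A → (A → ℕ) → ℕ
∑ xs f = sum (map f xs)

∑-↭ : (f : A → ℕ) {xs ys : List A} → xs ↭ ys → ∑ xs f ≡ ∑ ys f
∑-↭ f p = sum-↭ (↭-map⁺ f p)

∑-map : (g : A → B) (f : B → ℕ) (xs : List A) → ∑ (map g xs) f ≡ ∑ xs (f ∘ g)
∑-map g f xs = cong sum (sym (map-∘ xs))

∑-cong : {f g : A → ℕ} → f ≗ g → (xs : List A) → ∑ xs f ≡ ∑ xs g
∑-cong f≗g xs = cong sum (map-cong f≗g xs)

∑-cong-∈ : {f g : A → ℕ} (xs : List A) → (∀ {x} → x ∈ xs → f x ≡ g x) → ∑ xs f ≡ ∑ xs g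
∑-cong-∈ xs f≗g = cong sum (map-cong-local (All.tabulate f≗g))

∑-zero : (xs : List A) → ∑ xs (λ _ → 0) ≡ 0
∑-zero [] = refl
∑-zero (_ ∷ xs) = ∑-zero xs

∑-+ : (f g : A → ℕ) (xs : List A) → ∑ xs (λ x → f x + g x) ≡ ∑ xs f + ∑ xs g
∑-+ f g [] = refl
∑-+ f g (x ∷ xs) = trans (cong (f x + g x +_) (∑-+ f g xs)) (interchange (f x) (g x) (∑ xs f) (∑ xs g))

∑-comm : (f : A → B → ℕ) (xs : List A) (ys : List B) →
  ∑ xs (λ x → ∑ ys (f x)) ≡ ∑ ys (λ y → ∑ xs (λ x → f x y))
∑-comm f [] ys = sym (∑-zero ys)
∑-comm f (x ∷ xs) ys = trans (cong (∑ ys (f x) +_) (∑-comm f xs ys)) (sym (∑-+ (f x) _ ys))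

length-filter-T? : (p : A → Bool) (xs : List A) → length (filter (T? ∘ p) xs) ≡ ∑ xs (𝟙 ∘ p)
length-filter-T? p [] = refl
length-filter-T? p (x ∷ xs) with p x
... | true = cong suc (length-filter-T? p xs)
... | false = length-filter-T? p xs

∑-𝟙-none : (p : A → Bool) (xs : List A) → (∀ {x} → x ∈ xs → T (p x) → ⊥) → ∑ xs (𝟙 ∘ p) ≡ 0
∑-𝟙-none p [] none = refl
∑-𝟙-none p (x ∷ xs) none with p x in px
... | true = ⊥-elim (none (here refl) (subst T (sym px) _))
... | false = ∑-𝟙-none p xs (none ∘ there)

∑-𝟙-unique : (p : A → Bool) {xs : List A} {x₀ : A} → Unique xs → x₀ ∈ xs → T (p x₀) →
  (∀ {x} → T (p x) → x ≡ x₀) → ∑ xs (𝟙 ∘ p) ≡ 1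
∑-𝟙-unique p {x ∷ xs} (x∉xs ∷ _) (here refl) px₀ only with p x
... | true = cong suc (∑-𝟙-none p xs λ y∈xs py → All.lookup x∉xs y∈xs (sym (only py)))
∑-𝟙-unique p {x ∷ xs} (x∉xs ∷ u) (there x₀∈xs) px₀ only with p x in px
... | true = ⊥-elim (All.lookup x∉xs x₀∈xs (only (subst T (sym px) _)))
... | false = ∑-𝟙-unique p u x₀∈xs px₀ only

allᵇ-↭ : (p : A → Bool) {xs ys : List A} → xs ↭ ys → allᵇ p xs ≡ allᵇ p ys
allᵇ-↭ p ↭.refl = refl
allᵇ-↭ p (↭.prep x q) = cong (p x ∧_) (allᵇ-↭ p q)
allᵇ-↭ p (↭.swap x y q) with p x | p y
... | true | true = allᵇ-↭ p q
... | true | false = refl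
... | false | true = refl
... | false | false = refl
allᵇ-↭ p (↭.trans q r) = trans (allᵇ-↭ p q) (allᵇ-↭ p r)

allᵇ-map : (f : A → B) (p : B → Bool) (xs : List A) → allᵇ p (map f xs) ≡ allᵇ (p ∘ f) xs
allᵇ-map f p [] = refl
allᵇ-map f p (x ∷ xs) = cong (p (f x) ∧_) (allᵇ-map f p xs)

allᵇ-cong : {p q : A → Bool} → p ≗ q → (xs : List A) → allᵇ p xs ≡ allᵇ q xs
allᵇ-cong p≗q [] = refl
allᵇ-cong p≗q (x ∷ xs) = cong₂ _∧_ (p≗q x) (allᵇ-cong p≗q xs)

T-allᵇ : (p : A → Bool) (xs : List A) → T (allᵇ p xs) ⇔ All (T ∘ p) xs
T-allᵇ p [] = mk⇔ (λ _ → []) (λ _ → _)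
T-allᵇ p (x ∷ xs) = mk⇔ ⇒ ⇐
  where
  ⇒ : T (p x ∧ allᵇ p xs) → All (T ∘ p) (x ∷ xs)
  ⇒ t = proj₁ (to T-∧ t) ∷ to (T-allᵇ p xs) (proj₂ (to T-∧ t))
  ⇐ : All (T ∘ p) (x ∷ xs) → T (p x ∧ allᵇ p xs)
  ⇐ (px ∷ pxs) = from T-∧ (px , from (T-allᵇ p xs) pxs)

-- Lists up to rotation and reflection

reflect : List A → List A
reflect [] = []
reflect (x ∷ xs) = x ∷ reverse xs

infix 4 _⇝_
infixr 5 rot∷_ ref∷_

data _⇝_ {A : Set} : List A → List A → Set where
  ε : {w : List A} → w ⇝ w
  rot∷_ : {w v : List A} → rotate w ⇝ v → w ⇝ v
  ref∷_ : {w v : List A} → reflect w ⇝ v → w ⇝ v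

⇝-trans : {u v w : List A} → u ⇝ v → v ⇝ w → u ⇝ w
⇝-trans ε q = q
⇝-trans (rot∷ p) q = rot∷ ⇝-trans p q
⇝-trans (ref∷ p) q = ref∷ ⇝-trans p q

map-rotate : (f : A → B) (w : List A) → map f (rotate w) ≡ rotate (map f w)
map-rotate f [] = refl
map-rotate f (x ∷ w) = map-++ f w [ x ]

map-reflect : (f : A → B) (w : List A) → map f (reflect w) ≡ reflect (map f w)
map-reflect f [] = refl
map-reflect f (x ∷ w) = cong (f x ∷_) (reverse-map f w)

⇝-map : (f : A → B) {w v : List A} → w ⇝ v → map f w ⇝ map f v
⇝-map f ε = ε
⇝-map f {w} (rot∷ p) = rot∷ subst (_⇝ _) (map-rotate f w) (⇝-map f p)
⇝-map f {w} (ref∷ p) = ref∷ subst (_⇝ _) (map-reflect f w) (⇝-map f p)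

⇝-invariant : (F : List A → B) → F ∘ rotate ≗ F → F ∘ reflect ≗ F →
  {w v : List A} → w ⇝ v → F v ≡ F w
⇝-invariant F inv-rot inv-ref ε = refl
⇝-invariant F inv-rot inv-ref {w} (rot∷ p) = trans (⇝-invariant F inv-rot inv-ref p) (inv-rot w)
⇝-invariant F inv-rot inv-ref {w} (ref∷ p) = trans (⇝-invariant F inv-rot inv-ref p) (inv-ref w)

rotate-↭ : (w : List A) → rotate w ↭ w
rotate-↭ [] = ↭-refl
rotate-↭ (x ∷ w) = ↭-sym (∷↭∷ʳ x w)

reflect-↭ : (w : List A) → reflect w ↭ w
reflect-↭ [] = ↭-refl
reflect-↭ (x ∷ w) = ↭-prep x (↭-reverse w)

⇝⇒↭ : {w v : List A} → w ⇝ v → v ↭ w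
⇝⇒↭ ε = ↭-refl
⇝⇒↭ {w = w} (rot∷ p) = ↭-trans (⇝⇒↭ p) (rotate-↭ w)
⇝⇒↭ {w = w} (ref∷ p) = ↭-trans (⇝⇒↭ p) (reflect-↭ w)

++-⇝ : (a c : List A) → a ++ c ⇝ c ++ a
++-⇝ [] c = subst (c ⇝_) (sym (++-identityʳ c)) ε
++-⇝ (x ∷ a) c = rot∷ subst₂ _⇝_ (sym (++-assoc a c [ x ])) (++-assoc c [ x ] a) (++-⇝ a (c ∷ʳ x))

pathEdges : List A → List (A × A)
pathEdges (x ∷ y ∷ zs) = (x , y) ∷ pathEdges (y ∷ zs)
pathEdges _ = []

zipL-∷ʳ : (x y : A) (ys : List A) → zipL (y ∷ ys) (ys ∷ʳ x) ≡ pathEdges (y ∷ ys ∷ʳ x)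
zipL-∷ʳ x y [] = refl
zipL-∷ʳ x y (y′ ∷ ys) = cong ((y , y′) ∷_) (zipL-∷ʳ x y′ ys)

cycEdges-pathEdges : (x : A) (xs : List A) → cycEdges (x ∷ xs) ≡ pathEdges (x ∷ xs ∷ʳ x)
cycEdges-pathEdges x xs = zipL-∷ʳ x x xs

pathEdges-∷ʳ : (us : List A) (x y : A) → pathEdges (us ∷ʳ x ∷ʳ y) ≡ pathEdges (us ∷ʳ x) ∷ʳ (x , y)
pathEdges-∷ʳ [] x y = refl
pathEdges-∷ʳ (u ∷ []) x y = refl
pathEdges-∷ʳ (u ∷ u′ ∷ us) x y = cong ((u , u′) ∷_) (pathEdges-∷ʳ (u′ ∷ us) x y)

pathEdges-reverse : (v : List A) → pathEdges (reverse v) ≡ reverse (map swap (pathEdges v))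
pathEdges-reverse [] = refl
pathEdges-reverse (x ∷ []) = refl
pathEdges-reverse (x ∷ y ∷ zs) = begin
  pathEdges (reverse (x ∷ y ∷ zs))                   ≡⟨ cong pathEdges reverse-x∷y∷zs ⟩
  pathEdges (reverse zs ∷ʳ y ∷ʳ x)                   ≡⟨ pathEdges-∷ʳ (reverse zs) y x ⟩
  pathEdges (reverse zs ∷ʳ y) ∷ʳ (y , x)             ≡⟨ cong (λ l → pathEdges l ∷ʳ (y , x)) (unfold-reverse y zs) ⟨
  pathEdges (reverse (y ∷ zs)) ∷ʳ (y , x)            ≡⟨ cong (_∷ʳ (y , x)) (pathEdges-reverse (y ∷ zs)) ⟩
  reverse (map swap (pathEdges (y ∷ zs))) ∷ʳ (y , x) ≡⟨ unfold-reverse (y , x) (map swap (pathEdges (y ∷ zs))) ⟨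
  reverse (map swap (pathEdges (x ∷ y ∷ zs)))        ∎
  where
  open ≡-Reasoning
  reverse-x∷y∷zs : reverse (x ∷ y ∷ zs) ≡ reverse zs ∷ʳ y ∷ʳ x
  reverse-x∷y∷zs = trans (unfold-reverse x (y ∷ zs)) (cong (_∷ʳ x) (unfold-reverse y zs))

cycEdges-rotate : (w : List A) → cycEdges (rotate w) ≡ rotate (cycEdges w)
cycEdges-rotate [] = refl
cycEdges-rotate (x ∷ []) = refl
cycEdges-rotate (x ∷ y ∷ ys) = begin
  cycEdges (y ∷ ys ∷ʳ x)                 ≡⟨ cycEdges-pathEdges y (ys ∷ʳ x) ⟩
  pathEdges ((y ∷ ys) ∷ʳ x ∷ʳ y)         ≡⟨ pathEdges-∷ʳ (y ∷ ys) x y ⟩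
  pathEdges (y ∷ ys ∷ʳ x) ∷ʳ (x , y)     ≡⟨ cong rotate (cycEdges-pathEdges x (y ∷ ys)) ⟨
  rotate (cycEdges (x ∷ y ∷ ys))         ∎
  where open ≡-Reasoning

cycEdges-reflect : (w : List A) → cycEdges (reflect w) ≡ reverse (map swap (cycEdges w))
cycEdges-reflect [] = refl
cycEdges-reflect (x ∷ xs) = begin
  cycEdges (x ∷ reverse xs)                  ≡⟨ cycEdges-pathEdges x (reverse xs) ⟩
  pathEdges (x ∷ reverse xs ∷ʳ x)            ≡⟨ cong pathEdges reverse-∷-∷ʳ ⟨
  pathEdges (reverse (x ∷ xs ∷ʳ x))          ≡⟨ pathEdges-reverse (x ∷ xs ∷ʳ x) ⟩
  reverse (map swap (pathEdges (x ∷ xs ∷ʳ x))) ≡⟨ cong (reverse ∘ map swap) (cycEdges-pathEdges x xs) ⟨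
  reverse (map swap (cycEdges (x ∷ xs)))     ∎
  where
  open ≡-Reasoning
  reverse-∷-∷ʳ : reverse (x ∷ xs ∷ʳ x) ≡ x ∷ reverse xs ∷ʳ x
  reverse-∷-∷ʳ = trans (unfold-reverse x (xs ∷ʳ x)) (cong (_∷ʳ x) (reverse-++ xs [ x ]))

cycEdges-map : (f : A → B) (w : List A) → cycEdges (map f w) ≡ map (×.map f f) (cycEdges w)
cycEdges-map f [] = refl
cycEdges-map f (x ∷ w) = trans (cong (zipL (f x ∷ map f w)) (sym (map-++ f w [ x ]))) (zipL-map (x ∷ w) (w ∷ʳ x))
  where
  zipL-map : (as bs : List _) → zipL (map f as) (map f bs) ≡ map (×.map f f) (zipL as bs)
  zipL-map [] bs = refl
  zipL-map (a ∷ as) [] = refl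
  zipL-map (a ∷ as) (b ∷ bs) = cong ((f a , f b) ∷_) (zipL-map as bs)

cycEdges-⇝ : (F : List (A × A) → B) → (∀ {es fs} → es ↭ fs → F es ≡ F fs) → F ∘ map swap ≗ F →
  {w v : List A} → w ⇝ v → F (cycEdges v) ≡ F (cycEdges w)
cycEdges-⇝ F F-↭ F-swap = ⇝-invariant (F ∘ cycEdges) F-rotate F-reflect
  where
  F-rotate : ∀ w → F (cycEdges (rotate w)) ≡ F (cycEdges w)
  F-rotate w = trans (cong F (cycEdges-rotate w)) (F-↭ (rotate-↭ (cycEdges w)))
  F-reflect : ∀ w → F (cycEdges (reflect w)) ≡ F (cycEdges w)
  F-reflect w = trans (cong F (cycEdges-reflect w)) (trans (F-↭ (↭-reverse _)) (F-swap (cycEdges w)))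

infix 4 _≍_
_≍_ : A × A → A × A → Set
p ≍ q = p ≡ q ⊎ p ≡ swap q

≍-sym : {p q : A × A} → p ≍ q → q ≍ p
≍-sym (inj₁ refl) = inj₁ refl
≍-sym (inj₂ refl) = inj₂ refl

≍-trans : {p q r : A × A} → p ≍ q → q ≍ r → p ≍ r
≍-trans (inj₁ refl) q≍r = q≍r
≍-trans (inj₂ refl) (inj₁ refl) = inj₂ refl
≍-trans (inj₂ refl) (inj₂ refl) = inj₁ refl

Unique-↭ : {xs ys : List A} → xs ↭ ys → Unique xs → Unique ys
Unique-↭ {A = A} p = Permₛ.Unique-resp-↭ (setoid A) (↭⇒↭ₛ p)

Unique⇒∉-prefix : (a : List A) {m : A} {b : List A} → Unique (a ++ m ∷ b) → All (_≢ m) a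
Unique⇒∉-prefix [] _ = []
Unique⇒∉-prefix (x ∷ a) (x∉ ∷ u) = All.lookup x∉ (∈-++⁺ʳ a (here refl)) ∷ Unique⇒∉-prefix a u

reverse-++-∷ : (a : List A) (m : A) (b : List A) → reverse (a ++ m ∷ b) ≡ reverse b ++ m ∷ reverse a
reverse-++-∷ a m b = begin
  reverse (a ++ m ∷ b)             ≡⟨ reverse-++ a (m ∷ b) ⟩
  reverse (m ∷ b) ++ reverse a     ≡⟨ cong (_++ reverse a) (unfold-reverse m b) ⟩
  (reverse b ∷ʳ m) ++ reverse a    ≡⟨ ++-assoc (reverse b) [ m ] (reverse a) ⟩
  reverse b ++ m ∷ reverse a       ∎
  where open ≡-Reasoning

lastOr-∈ : (y : A) (ys : List A) → lastOr y ys ∈ y ∷ ys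
lastOr-∈ y [] = here refl
lastOr-∈ y (z ∷ zs) = there (lastOr-∈ z zs)

lastOr-∷ʳ : {y : A} {ys : List A} (xs : List A) {z : A} → y ∷ ys ≡ xs ∷ʳ z → lastOr y ys ≡ z
lastOr-∷ʳ [] refl = refl
lastOr-∷ʳ (x ∷ []) refl = refl
lastOr-∷ʳ (x ∷ x′ ∷ xs) refl = lastOr-∷ʳ (x′ ∷ xs) refl

reverse-∷ : (y : A) (ys : List A) → ∃ λ zs → reverse (y ∷ ys) ≡ lastOr y ys ∷ zs
reverse-∷ y [] = [] , refl
reverse-∷ y (z ∷ zs) with reverse-∷ z zs
... | zs′ , eq = zs′ ∷ʳ y , trans (unfold-reverse y (z ∷ zs)) (cong (_∷ʳ y) eq)

map-inverse : {f : A → B} {g : B → A} → (∀ x → g (f x) ≡ x) → (xs : List A) → map g (map f xs) ≡ xs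
map-inverse inv [] = refl
map-inverse inv (x ∷ xs) = cong₂ _∷_ (inv x) (map-inverse inv xs)

Unique-map-on : {f : A → B} {xs : List A} → (∀ {x y} → x ∈ xs → y ∈ xs → f x ≡ f y → x ≡ y) →
  Unique xs → Unique (map f xs)
Unique-map-on inj [] = []
Unique-map-on inj (x∉xs ∷ u) =
  All.map⁺ (All.tabulate λ y∈xs fx≡fy → All.lookup x∉xs y∈xs (inj (here refl) (there y∈xs) fx≡fy))
  ∷ Unique-map-on (λ x∈ y∈ → inj (there x∈) (there y∈)) u

map-↭-bijection : (Φ Ψ : A → A) {xs : List A} → Unique xs →
  (∀ {x} → x ∈ xs → Φ x ∈ xs) → (∀ {x} → x ∈ xs → Ψ x ∈ xs) →
  (∀ {x} → x ∈ xs → Ψ (Φ x) ≡ x) → (∀ {x} → x ∈ xs → Φ (Ψ x) ≡ x) →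
  map Φ xs ↭ xs
map-↭-bijection Φ Ψ u Φ∈ Ψ∈ ΨΦ ΦΨ = ∼bag⇒↭ (unique∧set⇒bag
  (Unique-map-on (λ x∈ y∈ eq → trans (sym (ΨΦ x∈)) (trans (cong Ψ eq) (ΨΦ y∈))) u) u
  (mk⇔ (λ x∈ → let (y , y∈ , x≡) = ∈-map⁻ Φ x∈ in subst (_∈ _) (sym x≡) (Φ∈ y∈))
       (λ x∈ → subst (_∈ map Φ _) (ΦΨ x∈) (∈-map⁺ Φ (Ψ∈ x∈)))))

-- Canonical representatives of cyclic vertex sequences

module _ {n : ℕ} where

  private
    code-vert : (b : Bool) (i : Fin n) (l : Fin 2) → code (vert b i l) ≡ (if b then 2 * n else 0) + toℕ (combine i l)
    code-vert b i l = trans (+-assoc (if b then 2 * n else 0) (2 * toℕ i) (toℕ l)) (cong (_ +_) (sym (toℕ-combine i l)))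

    2n+c≢c′ : (i i′ : Fin n) (l l′ : Fin 2) → 2 * n + toℕ (combine i l) ≢ toℕ (combine i′ l′)
    2n+c≢c′ i i′ l l′ eq = m+n≮m (2 * n) (toℕ (combine i l))
      (subst (_< 2 * n) (sym eq) (subst (toℕ (combine i′ l′) <_) (*-comm n 2) (toℕ<n (combine i′ l′))))

    vert-≡ : {b : Bool} {i i′ : Fin n} {l l′ : Fin 2} → combine i l ≡ combine i′ l′ → vert b i l ≡ vert b i′ l′
    vert-≡ {i = i} {i′} {l} {l′} eq with combine-injective i l i′ l′ eq
    ... | refl , refl = refl

  code-injective : {x y : Vtx n} → code x ≡ code y → x ≡ y
  code-injective {vert b i l} {vert b′ i′ l′} eq
    with b | b′ | trans (sym (code-vert b i l)) (trans eq (code-vert b′ i′ l′))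
  ... | true | true | eq′ = vert-≡ (toℕ-injective (+-cancelˡ-≡ (2 * n) _ _ eq′))
  ... | false | false | eq′ = vert-≡ (toℕ-injective eq′)
  ... | true | false | eq′ = ⊥-elim (2n+c≢c′ i i′ l l′ eq′)
  ... | false | true | eq′ = ⊥-elim (2n+c≢c′ i′ i l′ l (sym eq′))

  ==V⇔≡ : {x y : Vtx n} → T (x ==V y) ⇔ x ≡ y
  ==V⇔≡ {x} {y} = mk⇔ (code-injective ∘ ≡ᵇ⇒≡ (code x) (code y)) (≡⇒≡ᵇ (code x) (code y) ∘ cong code)

  private
    T-fresh : (x : Vtx n) (w : List (Vtx n)) → T (allᵇ (λ y → not (x ==V y)) w) ⇔ All (x ≢_) w
    T-fresh x [] = mk⇔ (λ _ → []) (λ _ → _)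
    T-fresh x (y ∷ w) with x ==V y in x==y
    ... | true = mk⇔ (λ ()) (λ { (x≢y ∷ _) → x≢y (to ==V⇔≡ (subst T (sym x==y) _)) })
    ... | false = mk⇔ (λ t → x≢y ∷ to (T-fresh x w) t) (λ { (_ ∷ x∉w) → from (T-fresh x w) x∉w })
      where
      x≢y : x ≢ y
      x≢y x≡y = subst T x==y (from ==V⇔≡ x≡y)

  distinctᵇ⇔Unique : {w : List (Vtx n)} → T (distinctᵇ w) ⇔ Unique w
  distinctᵇ⇔Unique {[]} = mk⇔ (λ _ → []) (λ _ → _)
  distinctᵇ⇔Unique {x ∷ w} = mk⇔
    (λ t → to (T-fresh x w) (to T-∧ t .proj₁) ∷ to distinctᵇ⇔Unique (to T-∧ t .proj₂))
    (λ { (x∉w ∷ u) → from T-∧ (from (T-fresh x w) x∉w , from distinctᵇ⇔Unique u) })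

  Minimal : Vtx n → List (Vtx n) → Set
  Minimal m w = All (λ y → code m ≤ code y) w

  cut : Vtx n → List (Vtx n) → List (Vtx n) × List (Vtx n)
  cut m [] = [] , []
  cut m (x ∷ xs) = if x ==V m then ([] , x ∷ xs) else ×.map₁ (x ∷_) (cut m xs)

  rotateTo : Vtx n → List (Vtx n) → List (Vtx n)
  rotateTo m w = proj₂ (cut m w) ++ proj₁ (cut m w)

  rotMin : List (Vtx n) → List (Vtx n)
  rotMin [] = []
  rotMin (x ∷ xs) = rotateTo (argmin code x xs) (x ∷ xs)

  argmin-∈ : (x : Vtx n) (xs : List (Vtx n)) → argmin code x xs ∈ x ∷ xs
  argmin-∈ x xs with argmin-sel code x xs
  ... | inj₁ eq = here eq
  ... | inj₂ m∈xs = there m∈xs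

  argmin-minimal : (x : Vtx n) (xs : List (Vtx n)) → Minimal (argmin code x xs) (x ∷ xs)
  argmin-minimal x xs = f[argmin]≤f[⊤] {f = code} x xs ∷ f[argmin]≤f[xs] {f = code} x xs

  minimal-unique : {m m′ : Vtx n} {w : List (Vtx n)} → m ∈ w → m′ ∈ w → Minimal m w → Minimal m′ w → m ≡ m′
  minimal-unique m∈w m′∈w min min′ = code-injective (≤-antisym (All.lookup min m′∈w) (All.lookup min′ m∈w))

  cut-∉ : {m : Vtx n} (a b : List (Vtx n)) → All (_≢ m) a → cut m (a ++ m ∷ b) ≡ (a , m ∷ b)
  cut-∉ {m} [] b [] with m ==V m in m==m
  ... | true = refl
  ... | false = ⊥-elim (subst T m==m (from (==V⇔≡ {x = m}) refl))
  cut-∉ {m} (x ∷ a) b (x≢m ∷ a∌m) with x ==V m in x==m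
  ... | true = ⊥-elim (x≢m (to (==V⇔≡ {x = x}) (subst T (sym x==m) _)))
  ... | false = cong (×.map₁ (x ∷_)) (cut-∉ a b a∌m)

  rotMin≡rotateTo : {m : Vtx n} (w : List (Vtx n)) → m ∈ w → Minimal m w → rotMin w ≡ rotateTo m w
  rotMin≡rotateTo (x ∷ xs) m∈w min =
    cong (λ z → rotateTo z (x ∷ xs)) (minimal-unique (argmin-∈ x xs) m∈w (argmin-minimal x xs) min)

  rotMin-split : (a : List (Vtx n)) (m : Vtx n) (b : List (Vtx n)) → Unique (a ++ m ∷ b) → Minimal m (a ++ m ∷ b) →
    rotMin (a ++ m ∷ b) ≡ m ∷ b ++ a
  rotMin-split a m b u min = trans (rotMin≡rotateTo (a ++ m ∷ b) (∈-++⁺ʳ a (here refl)) min)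
    (cong (λ (p : List (Vtx n) × List (Vtx n)) → proj₂ p ++ proj₁ p) (cut-∉ a b (Unique⇒∉-prefix a u)))

  data MinSplit : List (Vtx n) → Set where
    empty : MinSplit []
    split : (a : List (Vtx n)) (m : Vtx n) (b : List (Vtx n)) → Minimal m (a ++ m ∷ b) → MinSplit (a ++ m ∷ b)

  minSplit : (w : List (Vtx n)) → MinSplit w
  minSplit [] = empty
  minSplit (x ∷ xs) with ∈-∃++ (argmin-∈ x xs)
  ... | a , b , eq = subst MinSplit (sym eq) (split a m b (subst (Minimal m) eq (argmin-minimal x xs)))
    where
    m : Vtx n
    m = argmin code x xs

  rotMin-split-↭ : (a : List (Vtx n)) (m : Vtx n) (b : List (Vtx n)) {w : List (Vtx n)} → w ↭ a ++ m ∷ b →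
    Unique w → Minimal m w → rotMin (a ++ m ∷ b) ≡ m ∷ b ++ a
  rotMin-split-↭ a m b p u min = rotMin-split a m b (Unique-↭ p u) (All-resp-↭ p min)

  rotMin-⇝ : {w : List (Vtx n)} → Unique w → w ⇝ rotMin w
  rotMin-⇝ {w} u with minSplit w
  ... | empty = ε
  ... | split a m b min = subst (a ++ m ∷ b ⇝_) (sym (rotMin-split a m b u min)) (++-⇝ a (m ∷ b))

  rotMin-rotate : {w : List (Vtx n)} → Unique w → rotMin (rotate w) ≡ rotMin w
  rotMin-rotate {w} u with minSplit w
  ... | empty = refl
  ... | split [] m b min = begin
    rotMin (b ++ m ∷ [])  ≡⟨ rotMin-split-↭ b m [] (↭-sym (rotate-↭ (m ∷ b))) u min ⟩
    m ∷ b                 ≡⟨ cong (m ∷_) (++-identityʳ b) ⟨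
    m ∷ b ++ []           ≡⟨ rotMin-split [] m b u min ⟨
    rotMin (m ∷ b)        ∎
    where open ≡-Reasoning
  ... | split (x ∷ a) m b min = begin
    rotMin ((a ++ m ∷ b) ∷ʳ x)   ≡⟨ cong rotMin (++-assoc a (m ∷ b) [ x ]) ⟩
    rotMin (a ++ m ∷ b ∷ʳ x)     ≡⟨ rotMin-split-↭ a m (b ∷ʳ x) p u min ⟩
    m ∷ (b ∷ʳ x) ++ a            ≡⟨ cong (m ∷_) (++-assoc b [ x ] a) ⟩
    m ∷ b ++ x ∷ a               ≡⟨ rotMin-split (x ∷ a) m b u min ⟨
    rotMin (x ∷ a ++ m ∷ b)      ∎
    where
    open ≡-Reasoning
    p : x ∷ a ++ m ∷ b ↭ a ++ m ∷ b ∷ʳ x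
    p = subst (x ∷ a ++ m ∷ b ↭_) (++-assoc a (m ∷ b) [ x ]) (↭-sym (rotate-↭ (x ∷ a ++ m ∷ b)))

  rotMin-reflect : {w : List (Vtx n)} → Unique w → rotMin (reflect w) ≡ reflect (rotMin w)
  rotMin-reflect {w} u with minSplit w
  ... | empty = refl
  ... | split [] m b min = begin
    rotMin (m ∷ reverse b)       ≡⟨ rotMin-split-↭ [] m (reverse b) (↭-sym (reflect-↭ (m ∷ b))) u min ⟩
    m ∷ reverse b ++ []          ≡⟨ cong (m ∷_) (++-identityʳ (reverse b)) ⟩
    m ∷ reverse b                ≡⟨ cong (λ l → m ∷ reverse l) (++-identityʳ b) ⟨
    reflect (m ∷ b ++ [])        ≡⟨ cong reflect (rotMin-split [] m b u min) ⟨
    reflect (rotMin (m ∷ b))     ∎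
    where open ≡-Reasoning
  ... | split (x ∷ a) m b min = begin
    rotMin (x ∷ reverse (a ++ m ∷ b))     ≡⟨ cong (rotMin ∘ (x ∷_)) (reverse-++-∷ a m b) ⟩
    rotMin ((x ∷ reverse b) ++ m ∷ reverse a) ≡⟨ rotMin-split-↭ (x ∷ reverse b) m (reverse a) p u min ⟩
    m ∷ reverse a ++ x ∷ reverse b        ≡⟨ cong (m ∷_) (reverse-++-∷ b x a) ⟨
    reflect (m ∷ b ++ x ∷ a)              ≡⟨ cong reflect (rotMin-split (x ∷ a) m b u min) ⟨
    reflect (rotMin (x ∷ a ++ m ∷ b))     ∎
    where
    open ≡-Reasoning
    p : x ∷ a ++ m ∷ b ↭ (x ∷ reverse b) ++ m ∷ reverse a
    p = subst (x ∷ a ++ m ∷ b ↭_) (cong (x ∷_) (reverse-++-∷ a m b)) (↭-sym (reflect-↭ (x ∷ a ++ m ∷ b)))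

  orient : List (Vtx n) → List (Vtx n)
  orient (m ∷ y ∷ ys) = if code y <ᵇ code (lastOr y ys) then m ∷ y ∷ ys else reflect (m ∷ y ∷ ys)
  orient w = w

  canon : List (Vtx n) → List (Vtx n)
  canon w = orient (rotMin w)

  orient-⇝ : (w : List (Vtx n)) → w ⇝ orient w
  orient-⇝ (m ∷ y ∷ ys) with code y <ᵇ code (lastOr y ys)
  ... | true = ε
  ... | false = ref∷ ε
  orient-⇝ [] = ε
  orient-⇝ (_ ∷ []) = ε

  if-<ᵇ-swap : {X : Set} {p q : ℕ} (P Q : X) → p ≢ q → (if q <ᵇ p then Q else P) ≡ (if p <ᵇ q then P else Q)
  if-<ᵇ-swap {p = p} {q} P Q p≢q with p <ᵇ q in p<q | q <ᵇ p in q<p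
  ... | true | true = ⊥-elim (<-asym (<ᵇ⇒< p q (subst T (sym p<q) _)) (<ᵇ⇒< q p (subst T (sym q<p) _)))
  ... | true | false = refl
  ... | false | true = refl
  ... | false | false = ⊥-elim (p≢q (≤-antisym (≮⇒≥ (subst T q<p ∘ <⇒<ᵇ)) (≮⇒≥ (subst T p<q ∘ <⇒<ᵇ))))

  orient-reflect : (m y : Vtx n) (ys : List (Vtx n)) → y ≢ lastOr y ys →
    orient (reflect (m ∷ y ∷ ys)) ≡ orient (m ∷ y ∷ ys)
  orient-reflect m y ys y≢ℓ with reverse-∷ y ys
  ... | zs , rev≡ = begin
    orient (m ∷ reverse (y ∷ ys))
      ≡⟨ cong (orient ∘ (m ∷_)) rev≡ ⟩
    orient (m ∷ ℓ ∷ zs)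
      ≡⟨ cong₂ (λ z t → if code ℓ <ᵇ code z then m ∷ ℓ ∷ zs else m ∷ t) lastOr≡y reverse≡ ⟩
    (if code ℓ <ᵇ code y then m ∷ ℓ ∷ zs else m ∷ y ∷ ys)
      ≡⟨ if-<ᵇ-swap (m ∷ y ∷ ys) (m ∷ ℓ ∷ zs) (y≢ℓ ∘ code-injective) ⟩
    (if code y <ᵇ code ℓ then m ∷ y ∷ ys else m ∷ ℓ ∷ zs)
      ≡⟨ cong (λ t → if code y <ᵇ code ℓ then m ∷ y ∷ ys else m ∷ t) rev≡ ⟨
    orient (m ∷ y ∷ ys)
      ∎
    where
    open ≡-Reasoning
    ℓ : Vtx n
    ℓ = lastOr y ys
    lastOr≡y : lastOr ℓ zs ≡ y
    lastOr≡y = lastOr-∷ʳ (reverse ys) (trans (sym rev≡) (unfold-reverse y ys))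
    reverse≡ : reverse (ℓ ∷ zs) ≡ y ∷ ys
    reverse≡ = trans (cong reverse (sym rev≡)) (reverse-involutive (y ∷ ys))

  second≢last : {m y z : Vtx n} {zs : List (Vtx n)} → Unique (m ∷ y ∷ z ∷ zs) → y ≢ lastOr z zs
  second≢last (_ ∷ y∉ ∷ _) = All.lookup y∉ (lastOr-∈ _ _)

  head-below : {m : Vtx n} {rest : List (Vtx n)} → Unique (m ∷ rest) → Minimal m rest →
    T (allᵇ (λ w → code m <ᵇ code w) rest)
  head-below {m} {rest} (m∉ ∷ _) min = from (T-allᵇ _ rest)
    (All.tabulate λ w∈ → <⇒<ᵇ (≤∧≢⇒< (All.lookup min w∈) (All.lookup m∉ w∈ ∘ code-injective)))

  orient-canonical : {m : Vtx n} (rest : List (Vtx n)) → Unique (m ∷ rest) → Minimal m rest → 2 ≤ length rest →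
    T (canonicalᵇ (orient (m ∷ rest)))
  orient-canonical (_ ∷ []) _ _ (s≤s ())
  orient-canonical {m} (y ∷ z ∷ zs) u min _ with code y <ᵇ code (lastOr z zs) in y<ℓ
  ... | true = from T-∧ (head-below u min , subst T (sym y<ℓ) _)
  ... | false with reverse-∷ y (z ∷ zs)
  ...   | ws , rev≡ = subst (λ t → T (canonicalᵇ (m ∷ t))) (sym rev≡) (from T-∧ (below-ℓ∷ws , ℓ<y))
    where
    ℓ : Vtx n
    ℓ = lastOr z zs
    below-ℓ∷ws : T (allᵇ (λ w → code m <ᵇ code w) (ℓ ∷ ws))
    below-ℓ∷ws = subst T (trans (sym (allᵇ-↭ _ (↭-reverse (y ∷ z ∷ zs)))) (cong (allᵇ _) rev≡)) (head-below u min)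
    ℓ<y : T (code ℓ <ᵇ code (lastOr ℓ ws))
    ℓ<y = subst (λ x → T (code ℓ <ᵇ code x)) (sym lastOr≡y)
      (<⇒<ᵇ (≤∧≢⇒< (≮⇒≥ (subst T y<ℓ ∘ <⇒<ᵇ)) (second≢last u ∘ sym ∘ code-injective)))
      where
      lastOr≡y : lastOr ℓ ws ≡ y
      lastOr≡y = lastOr-∷ʳ (reverse (z ∷ zs)) (trans (sym rev≡) (unfold-reverse y (z ∷ zs)))

  canon-⇝ : {w : List (Vtx n)} → Unique w → w ⇝ canon w
  canon-⇝ {w} u = ⇝-trans (rotMin-⇝ u) (orient-⇝ (rotMin w))

  canon-rotate : {w : List (Vtx n)} → Unique w → canon (rotate w) ≡ canon w
  canon-rotate u = cong orient (rotMin-rotate u)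

  canon-reflect : {w : List (Vtx n)} → Unique w → 3 ≤ length w → canon (reflect w) ≡ canon w
  canon-reflect {w} u len = trans (cong orient (rotMin-reflect u))
    (orient-reflect′ (rotMin w) (Unique-↭ (↭-sym p) u) (subst (3 ≤_) (sym (↭-length p)) len))
    where
    p : rotMin w ↭ w
    p = ⇝⇒↭ (rotMin-⇝ u)
    orient-reflect′ : (v : List (Vtx n)) → Unique v → 3 ≤ length v → orient (reflect v) ≡ orient v
    orient-reflect′ (m ∷ y ∷ z ∷ zs) u _ = orient-reflect m y (z ∷ zs) (second≢last u)
    orient-reflect′ (_ ∷ []) _ (s≤s ())
    orient-reflect′ (_ ∷ _ ∷ []) _ (s≤s (s≤s ()))

  canon-⇝-invariant : {w v : List (Vtx n)} → Unique w → 3 ≤ length w → w ⇝ v → canon v ≡ canon w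
  canon-⇝-invariant u len ε = refl
  canon-⇝-invariant {w} u len (rot∷ p) = trans
    (canon-⇝-invariant (Unique-↭ (↭-sym (rotate-↭ w)) u) (subst (3 ≤_) (sym (↭-length (rotate-↭ w))) len) p)
    (canon-rotate u)
  canon-⇝-invariant {w} u len (ref∷ p) = trans
    (canon-⇝-invariant (Unique-↭ (↭-sym (reflect-↭ w)) u) (subst (3 ≤_) (sym (↭-length (reflect-↭ w))) len) p)
    (canon-reflect u len)

  canon-canonical : {w : List (Vtx n)} → Unique w → 3 ≤ length w → T (canonicalᵇ (canon w))
  canon-canonical {w} u len with minSplit w
  ... | split a m b min = subst (T ∘ canonicalᵇ ∘ orient) (sym (rotMin-split a m b u min))
    (orient-canonical (b ++ a) (Unique-↭ p u) (All.tail (All-resp-↭ p min))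
      (s≤s⁻¹ (subst (3 ≤_) (↭-length p) len)))
    where
    p : a ++ m ∷ b ↭ m ∷ b ++ a
    p = ++-comm a (m ∷ b)

  canon-fixed : {w : List (Vtx n)} → Unique w → T (canonicalᵇ w) → canon w ≡ w
  canon-fixed {[]} _ ()
  canon-fixed {_ ∷ []} _ ()
  canon-fixed {m ∷ y ∷ ys} u c =
    trans (cong orient (trans (rotMin-split [] m (y ∷ ys) u min) (cong (m ∷_) (++-identityʳ (y ∷ ys)))))
          (cong (λ b → if b then m ∷ y ∷ ys else reflect (m ∷ y ∷ ys)) (to T-≡ (proj₂ (to T-∧ c))))
    where
    min : Minimal m (m ∷ y ∷ ys)
    min = ≤-refl ∷ All.map (<⇒≤ ∘ <ᵇ⇒< _ _) (to (T-allᵇ _ (y ∷ ys)) (proj₁ (to T-∧ c)))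

concatMap-map : (f : A → B → C) (xs : List A) (ys : List B) →
  concatMap (λ x → map (f x) ys) xs ≡ cartesianProductWith f xs ys
concatMap-map f [] ys = refl
concatMap-map f (x ∷ xs) ys = cong (map (f x) ys ++_) (concatMap-map f xs ys)

module _ {n : ℕ} where

  vertsOf : Bool → List (Vtx n)
  vertsOf b = concatMap (λ i → map (vert b i) (allFin 2)) (allFin n)

  private
    vertsOf≡ : (b : Bool) → vertsOf b ≡ cartesianProductWith (vert b) (allFin n) (allFin 2)
    vertsOf≡ b = concatMap-map (vert b) (allFin n) (allFin 2)

    vertsOf-unique : (b : Bool) → Unique (vertsOf b)
    vertsOf-unique b = subst Unique (sym (vertsOf≡ b))
      (cartesianProductWith⁺ (vert b) vert-injective (allFin⁺ n) (allFin⁺ 2))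
      where
      vert-injective : ∀ {i i′ l l′} → vert b i l ≡ vert b i′ l′ → i ≡ i′ × l ≡ l′
      vert-injective refl = refl , refl

    ∈-vertsOf : (b : Bool) (i : Fin n) (l : Fin 2) → vert b i l ∈ vertsOf b
    ∈-vertsOf b i l = subst (vert b i l ∈_) (sym (vertsOf≡ b))
      (∈-cartesianProductWith⁺ (vert b) (∈-allFin i) (∈-allFin l))

    isInner-vertsOf : {b : Bool} {x : Vtx n} → x ∈ vertsOf b → isInner x ≡ b
    isInner-vertsOf {b} x∈
      with ∈-cartesianProductWith⁻ (vert b) (allFin n) (allFin 2) (subst (_ ∈_) (vertsOf≡ b) x∈)
    ... | _ , _ , _ , _ , refl = refl

  ∈-allVtx : (x : Vtx n) → x ∈ allVtx n
  ∈-allVtx (vert true i l) = ∈-++⁺ˡ (∈-vertsOf true i l)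
  ∈-allVtx (vert false i l) = ∈-++⁺ʳ (vertsOf true) (∈-++⁺ˡ (∈-vertsOf false i l))

  allVtx-unique : Unique (allVtx n)
  allVtx-unique = ++⁺ (vertsOf-unique true) (++⁺ (vertsOf-unique false) [] λ { (_ , ()) }) disjoint
    where
    disjoint : ∀ {x} → x ∈ vertsOf true × x ∈ vertsOf false ++ [] → ⊥
    disjoint (x∈T , x∈F) with ∈-++⁻ (vertsOf false) x∈F
    ... | inj₁ x∈F′ with () ← trans (sym (isInner-vertsOf x∈T)) (isInner-vertsOf x∈F′)

allSeqs≡ : (xs : List A) (m : ℕ) → allSeqs xs (suc m) ≡ cartesianProductWith _∷_ xs (allSeqs xs m)
allSeqs≡ xs m = concatMap-map _∷_ xs (allSeqs xs m)

allSeqs-unique : {xs : List A} → Unique xs → (m : ℕ) → Unique (allSeqs xs m)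
allSeqs-unique u zero = [] ∷ []
allSeqs-unique {xs = xs} u (suc m) =
  subst Unique (sym (allSeqs≡ xs m)) (cartesianProductWith⁺ _∷_ ∷-injective u (allSeqs-unique u m))

∈-allSeqs⁺ : {xs w : List A} → All (_∈ xs) w → w ∈ allSeqs xs (length w)
∈-allSeqs⁺ [] = here refl
∈-allSeqs⁺ {xs = xs} {x ∷ w} (x∈ ∷ w⊆) =
  subst (_ ∈_) (sym (allSeqs≡ xs (length w))) (∈-cartesianProductWith⁺ _∷_ x∈ (∈-allSeqs⁺ w⊆))

∈-allSeqs⁻ : {xs w : List A} (m : ℕ) → w ∈ allSeqs xs m → length w ≡ m
∈-allSeqs⁻ zero (here refl) = refl
∈-allSeqs⁻ {xs = xs} (suc m) w∈
  with ∈-cartesianProductWith⁻ _∷_ xs (allSeqs xs m) (subst (_ ∈_) (allSeqs≡ xs m) w∈)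
... | _ , _ , _ , w′∈ , refl = cong suc (∈-allSeqs⁻ m w′∈)

module _ {n k : ℕ} .{{_ : NonZero n}} {j : ℕ} where

  ∈-cycles⁺ : {w : List (Vtx n)} → length w ≡ j → T (isCanonCycleᵇ n k w) → w ∈ cycles n k j
  ∈-cycles⁺ {w} refl c = ∈-filter⁺ (T? ∘ isCanonCycleᵇ n k) (∈-allSeqs⁺ (All.tabulate λ {x} _ → ∈-allVtx x)) c

  ∈-cycles⁻ : {w : List (Vtx n)} → w ∈ cycles n k j → length w ≡ j × T (isCanonCycleᵇ n k w)
  ∈-cycles⁻ w∈ with ∈-filter⁻ (T? ∘ isCanonCycleᵇ n k) w∈
  ... | w∈seqs , c = ∈-allSeqs⁻ j w∈seqs , c

  cycles-unique : Unique (cycles n k j)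
  cycles-unique = filter⁺ (T? ∘ isCanonCycleᵇ n k) (allSeqs-unique allVtx-unique j)

[m%n+k]%n≡[m+k]%n : ∀ m k n .{{_ : NonZero n}} → (m % n + k) % n ≡ (m + k) % n
[m%n+k]%n≡[m+k]%n m k n = trans (%-distribˡ-+ (m % n) k n)
  (trans (cong (λ z → (z + k % n) % n) (m%n%n≡m%n m n)) (sym (%-distribˡ-+ m k n)))

[m+d]%n≢m : ∀ {m d n} .{{_ : NonZero n}} → m < n → 0 < d → d < n → (m + d) % n ≢ m
[m+d]%n≢m {m} {d} {n} m<n 0<d d<n eq with m + d <? n
... | yes m+d<n = <⇒≢ (m<m+n m 0<d) (sym (trans (sym (m<n⇒m%n≡m m+d<n)) eq))
... | no m+d≮n = <⇒≢ d<n (+-cancelˡ-≡ m d n (trans (sym (m∸n+n≡m n≤m+d)) (cong (_+ n) m+d∸n≡m)))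
  where
  open ≡-Reasoning
  n≤m+d : n ≤ m + d
  n≤m+d = ≮⇒≥ m+d≮n
  m+d∸n<n : m + d ∸ n < n
  m+d∸n<n = subst (m + d ∸ n <_) (m+n∸n≡m n n) (∸-monoˡ-< (+-mono-< m<n d<n) n≤m+d)
  m+d∸n≡m : m + d ∸ n ≡ m
  m+d∸n≡m = begin
    m + d ∸ n          ≡⟨ m<n⇒m%n≡m m+d∸n<n ⟨
    (m + d ∸ n) % n    ≡⟨ m≤n⇒[n∸m]%m≡n%m n≤m+d ⟩
    (m + d) % n        ≡⟨ eq ⟩
    m                  ∎

module _ {n : ℕ} .{{_ : NonZero n}} where

  infixl 6 _⊕_

  _⊕_ : Fin n → ℕ → Fin n
  i ⊕ s = (toℕ i + s) mod n

  toℕ-⊕ : (i : Fin n) (s : ℕ) → toℕ (i ⊕ s) ≡ (toℕ i + s) % n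
  toℕ-⊕ i s = toℕ-fromℕ< _

  ⊕-assoc : (i : Fin n) (s t : ℕ) → i ⊕ s ⊕ t ≡ i ⊕ (s + t)
  ⊕-assoc i s t = toℕ-injective (begin
    toℕ (i ⊕ s ⊕ t)           ≡⟨ toℕ-⊕ (i ⊕ s) t ⟩
    (toℕ (i ⊕ s) + t) % n     ≡⟨ cong (λ z → (z + t) % n) (toℕ-⊕ i s) ⟩
    ((toℕ i + s) % n + t) % n ≡⟨ [m%n+k]%n≡[m+k]%n (toℕ i + s) t n ⟩
    (toℕ i + s + t) % n       ≡⟨ cong (_% n) (+-assoc (toℕ i) s t) ⟩
    (toℕ i + (s + t)) % n     ≡⟨ toℕ-⊕ i (s + t) ⟨
    toℕ (i ⊕ (s + t))         ∎)
    where open ≡-Reasoning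

  ⊕-comm : (i : Fin n) (s t : ℕ) → i ⊕ s ⊕ t ≡ i ⊕ t ⊕ s
  ⊕-comm i s t = trans (⊕-assoc i s t) (trans (cong (i ⊕_) (+-comm s t)) (sym (⊕-assoc i t s)))

  ⊕-inverse : (i : Fin n) {s : ℕ} → s ≤ n → i ⊕ s ⊕ (n ∸ s) ≡ i
  ⊕-inverse i {s} s≤n = begin
    i ⊕ s ⊕ (n ∸ s)   ≡⟨ ⊕-assoc i s (n ∸ s) ⟩
    i ⊕ (s + (n ∸ s)) ≡⟨ cong (i ⊕_) (m+[n∸m]≡n s≤n) ⟩
    i ⊕ n             ≡⟨ toℕ-injective (trans (toℕ-⊕ i n) i+n%n≡i) ⟩
    i                 ∎
    where
    open ≡-Reasoning
    i+n%n≡i : (toℕ i + n) % n ≡ toℕ i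
    i+n%n≡i = trans ([m+n]%n≡m%n (toℕ i) n) (m<n⇒m%n≡m (toℕ<n i))

  origin : Fin n
  origin = 0 mod n

  origin-⊕ : (i : Fin n) → origin ⊕ toℕ i ≡ i
  origin-⊕ i = toℕ-injective (begin
    toℕ (origin ⊕ toℕ i)      ≡⟨ toℕ-⊕ origin (toℕ i) ⟩
    (toℕ origin + toℕ i) % n  ≡⟨ cong (λ z → (z + toℕ i) % n) (toℕ-fromℕ< _) ⟩
    (0 % n + toℕ i) % n       ≡⟨ [m%n+k]%n≡[m+k]%n 0 (toℕ i) n ⟩
    toℕ i % n                 ≡⟨ m<n⇒m%n≡m (toℕ<n i) ⟩
    toℕ i                     ∎)
    where open ≡-Reasoning

  stepᵇ⇔ : (s : ℕ) (i i′ : Fin n) → T (stepᵇ n s i i′) ⇔ i ⊕ s ≡ i′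
  stepᵇ⇔ s i i′ = mk⇔
    (λ t → toℕ-injective (trans (toℕ-⊕ i s) (≡ᵇ⇒≡ _ _ t)))
    (λ eq → ≡⇒≡ᵇ _ _ (trans (sym (toℕ-⊕ i s)) (cong toℕ eq)))

  no-back-and-forth : {t : ℕ} → 0 < t → 2 * t < n → (i i′ : Fin n) → i ⊕ t ≡ i′ → i′ ⊕ t ≢ i
  no-back-and-forth {t} 0<t 2t<n i i′ fwd bwd =
    [m+d]%n≢m (toℕ<n i) (<-≤-trans 0<t (m≤m+n t t)) (subst (_< n) (cong (t +_) (+-identityʳ t)) 2t<n) (begin
      (toℕ i + (t + t)) % n  ≡⟨ toℕ-⊕ i (t + t) ⟨
      toℕ (i ⊕ (t + t))      ≡⟨ cong toℕ (⊕-assoc i t t) ⟨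
      toℕ (i ⊕ t ⊕ t)        ≡⟨ cong (λ z → toℕ (z ⊕ t)) fwd ⟩
      toℕ (i′ ⊕ t)           ≡⟨ cong toℕ bwd ⟩
      toℕ i                  ∎)
    where open ≡-Reasoning

-- Edges and automorphisms of DGP(n,k)

other : Fin 2 → Fin 2
other 0F = sucF 0F
other (sucF 0F) = 0F

other-involutive : (l : Fin 2) → other (other l) ≡ l
other-involutive 0F = refl
other-involutive (sucF 0F) = refl

flipᵇ⇔ : (l l′ : Fin 2) → T (flipᵇ l l′) ⇔ l′ ≡ other l
flipᵇ⇔ 0F 0F = mk⇔ (λ ()) (λ ())
flipᵇ⇔ 0F (sucF 0F) = mk⇔ (λ _ → refl) (λ _ → _)
flipᵇ⇔ (sucF 0F) 0F = mk⇔ (λ _ → refl) (λ _ → _)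
flipᵇ⇔ (sucF 0F) (sucF 0F) = mk⇔ (λ ()) (λ ())

flipᵇ-sym : (l l′ : Fin 2) → flipᵇ l l′ ≡ flipᵇ l′ l
flipᵇ-sym 0F 0F = refl
flipᵇ-sym 0F (sucF 0F) = refl
flipᵇ-sym (sucF 0F) 0F = refl
flipᵇ-sym (sucF 0F) (sucF 0F) = refl

≡ᵇ-sym : (a b : ℕ) → (a ≡ᵇ b) ≡ (b ≡ᵇ a)
≡ᵇ-sym zero zero = refl
≡ᵇ-sym zero (suc b) = refl
≡ᵇ-sym (suc a) zero = refl
≡ᵇ-sym (suc a) (suc b) = ≡ᵇ-sym a b

module _ {n : ℕ} .{{_ : NonZero n}} where

  edge : ℕ → EType → Fin n × Fin 2 → Vtx n × Vtx n
  edge k outer (i , l) = vert false i l , vert false (i ⊕ 1) (other l)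
  edge k spoke (i , l) = vert false i l , vert true i (other l)
  edge k inner (i , l) = vert true i l , vert true (i ⊕ k) (other l)

  shiftV : ℕ → Vtx n → Vtx n
  shiftV s (vert b i l) = vert b (i ⊕ s) l

  swapLayer : Vtx n → Vtx n
  swapLayer (vert b i l) = vert b i (other l)

ring : Bool → EType
ring false = outer
ring true = inner

spoke≢ring : (b : Bool) → spoke ≢ ring b
spoke≢ring false ()
spoke≢ring true ()

module _ {n k : ℕ} .{{_ : NonZero n}} where

  private
    IsEdge : EType → Vtx n × Vtx n → Set
    IsEdge e (x , y) = T (isEdgeOfType n k e x y)

  isEdge-sym : (e : EType) (x y : Vtx n) → isEdgeOfType n k e x y ≡ isEdgeOfType n k e y x
  isEdge-sym outer (vert false i l) (vert false i′ l′) = cong₂ _∧_ (flipᵇ-sym l l′) (∨-comm (stepᵇ n 1 i i′) _)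
  isEdge-sym inner (vert true i l) (vert true i′ l′) = cong₂ _∧_ (flipᵇ-sym l l′) (∨-comm (stepᵇ n k i i′) _)
  isEdge-sym spoke (vert false i l) (vert true i′ l′) = cong₂ _∧_ (flipᵇ-sym l l′) (≡ᵇ-sym (toℕ i) _)
  isEdge-sym spoke (vert true i l) (vert false i′ l′) = cong₂ _∧_ (flipᵇ-sym l l′) (≡ᵇ-sym (toℕ i) _)
  isEdge-sym outer (vert false _ _) (vert true _ _) = refl
  isEdge-sym outer (vert true _ _) (vert false _ _) = refl
  isEdge-sym outer (vert true _ _) (vert true _ _) = refl
  isEdge-sym inner (vert false _ _) (vert false _ _) = refl
  isEdge-sym inner (vert false _ _) (vert true _ _) = refl
  isEdge-sym inner (vert true _ _) (vert false _ _) = refl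
  isEdge-sym spoke (vert false _ _) (vert false _ _) = refl
  isEdge-sym spoke (vert true _ _) (vert true _ _) = refl

  adj-sym : (x y : Vtx n) → adjᵇ n k x y ≡ adjᵇ n k y x
  adj-sym x y = cong₂ _∨_ (isEdge-sym outer x y) (cong₂ _∨_ (isEdge-sym spoke x y) (isEdge-sym inner x y))

  isEdge-≍ : (e : EType) {p q : Vtx n × Vtx n} → p ≍ q → IsEdge e q → IsEdge e p
  isEdge-≍ e (inj₁ refl) q-edge = q-edge
  isEdge-≍ e {q = x , y} (inj₂ refl) q-edge = subst T (isEdge-sym e x y) q-edge

  private
    circulant-edge : (t : ℕ) (i : Fin n) (l : Fin 2) →
      T (flipᵇ l (other l) ∧ (stepᵇ n t i (i ⊕ t) ∨ stepᵇ n t (i ⊕ t) i))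
    circulant-edge t i l = from T-∧ (from (flipᵇ⇔ l _) refl , from T-∨ (inj₁ (from (stepᵇ⇔ t i _) refl)))

    circulant-edge⁻ : (b : Bool) (t : ℕ) (i i′ : Fin n) (l l′ : Fin 2) →
      T (flipᵇ l l′ ∧ (stepᵇ n t i i′ ∨ stepᵇ n t i′ i)) →
      ∃ λ ((j , m) : Fin n × Fin 2) → (vert b i l , vert b i′ l′) ≍ (vert b j m , vert b (j ⊕ t) (other m))
    circulant-edge⁻ b t i i′ l l′ h with to (flipᵇ⇔ l l′) (proj₁ (to T-∧ h)) | to T-∨ (proj₂ (to T-∧ h))
    ... | refl | inj₁ s =
      (i , l) , inj₁ (cong (λ z → vert b i l , vert b z (other l)) (sym (to (stepᵇ⇔ t i i′) s)))
    ... | refl | inj₂ s = (i′ , other l) , inj₂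
      (cong₂ (λ z w → vert b z w , vert b i′ (other l)) (sym (to (stepᵇ⇔ t i′ i) s)) (sym (other-involutive l)))

    spoke-edge⁻ : (i i′ : Fin n) (l l′ : Fin 2) → T (flipᵇ l l′ ∧ (toℕ i ≡ᵇ toℕ i′)) → i ≡ i′ × l′ ≡ other l
    spoke-edge⁻ i i′ l l′ h = toℕ-injective (≡ᵇ⇒≡ _ _ (proj₂ (to T-∧ h))) , to (flipᵇ⇔ l l′) (proj₁ (to T-∧ h))

  edge-isEdge : (e : EType) (ι : Fin n × Fin 2) → IsEdge e (edge k e ι)
  edge-isEdge outer (i , l) = circulant-edge 1 i l
  edge-isEdge inner (i , l) = circulant-edge k i l
  edge-isEdge spoke (i , l) = from T-∧ (from (flipᵇ⇔ l _) refl , ≡⇒≡ᵇ (toℕ i) (toℕ i) refl)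

  isEdge⇒edge : (e : EType) (p : Vtx n × Vtx n) → IsEdge e p → ∃ λ ι → p ≍ edge k e ι
  isEdge⇒edge outer (vert false i l , vert false i′ l′) h = circulant-edge⁻ false 1 i i′ l l′ h
  isEdge⇒edge inner (vert true i l , vert true i′ l′) h = circulant-edge⁻ true k i i′ l l′ h
  isEdge⇒edge spoke (vert false i l , vert true i′ l′) h with spoke-edge⁻ i i′ l l′ h
  ... | refl , refl = (i , l) , inj₁ refl
  isEdge⇒edge spoke (vert true i l , vert false i′ l′) h with spoke-edge⁻ i i′ l l′ h
  ... | refl , refl = (i , l′) , inj₂ (cong (λ m → vert true i m , vert false i l′) (sym (other-involutive l)))

  -- An outer or inner edge equal to another one reversed would give i ⊕ t ⊕ t ≡ i, impossible as 0 < 2t < n.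
  edge-injective : 1 ≤ k → 2 * k < n → (e : EType) {ι ι′ : Fin n × Fin 2} → edge k e ι ≍ edge k e ι′ → ι ≡ ι′
  edge-injective _ _ e {ι} {ι′} (inj₁ eq) =
    trans (sym (source e ι)) (trans (cong (λ p → idx (proj₁ p) , lay (proj₁ p)) eq) (source e ι′))
    where
    source : (e : EType) (ι : Fin n × Fin 2) → (idx (proj₁ (edge k e ι)) , lay (proj₁ (edge k e ι))) ≡ ι
    source outer _ = refl
    source spoke _ = refl
    source inner _ = refl
  edge-injective 1≤k 2k<n outer {i , _} {i′ , _} (inj₂ eq) =
    ⊥-elim (no-back-and-forth (s≤s z≤n) (≤-<-trans (*-monoʳ-≤ 2 1≤k) 2k<n) i i′
      (cong (idx ∘ proj₂) eq) (sym (cong (idx ∘ proj₁) eq)))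
  edge-injective 1≤k 2k<n inner {i , _} {i′ , _} (inj₂ eq) =
    ⊥-elim (no-back-and-forth 1≤k 2k<n i i′ (cong (idx ∘ proj₂) eq) (sym (cong (idx ∘ proj₁) eq)))
  edge-injective _ _ spoke (inj₂ eq) with () ← cong (isInner ∘ proj₁) eq

  adj-intro : (e : EType) (x y : Vtx n) → IsEdge e (x , y) → Adj n k x y
  adj-intro e x y h = from (T-∨ {isEdgeOfType n k outer x y}) (case e h)
    where
    case : (e : EType) → IsEdge e (x , y) →
      T (isEdgeOfType n k outer x y) ⊎ T (isEdgeOfType n k spoke x y ∨ isEdgeOfType n k inner x y)
    case outer h = inj₁ h
    case spoke h = inj₂ (from (T-∨ {isEdgeOfType n k spoke x y}) (inj₁ h))
    case inner h = inj₂ (from (T-∨ {isEdgeOfType n k spoke x y}) (inj₂ h))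

  adj-type : (x y : Vtx n) → Adj n k x y → ∃ λ e → IsEdge e (x , y)
  adj-type x y a with to T-∨ a
  ... | inj₁ h = outer , h
  ... | inj₂ a′ with to T-∨ a′
  ...   | inj₁ h = spoke , h
  ...   | inj₂ h = inner , h

  EdgePreserving : (Vtx n → Vtx n) → Set
  EdgePreserving f = ∀ e ι → ∃ λ ι′ → ×.map f f (edge k e ι) ≡ edge k e ι′

  edgePreserving⇒isEdge : {f : Vtx n → Vtx n} → EdgePreserving f →
    (e : EType) (p : Vtx n × Vtx n) → IsEdge e p → IsEdge e (×.map f f p)
  edgePreserving⇒isEdge {f} pres e p h with isEdge⇒edge e p h
  ... | ι , p≍ with pres e ι
  ...   | ι′ , eq = isEdge-≍ e (subst (×.map f f p ≍_) eq (≍-map p≍)) (edge-isEdge e ι′)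
    where
    ≍-map : {q r : Vtx n × Vtx n} → q ≍ r → ×.map f f q ≍ ×.map f f r
    ≍-map (inj₁ refl) = inj₁ refl
    ≍-map (inj₂ refl) = inj₂ refl

  edgePreserving⇒adj : {f : Vtx n → Vtx n} → EdgePreserving f → (x y : Vtx n) → Adj n k x y → Adj n k (f x) (f y)
  edgePreserving⇒adj {f} pres x y a with adj-type x y a
  ... | e , h = adj-intro e (f x) (f y) (edgePreserving⇒isEdge pres e (x , y) h)

  automorphism : (f g : Vtx n → Vtx n) → (∀ x → f (g x) ≡ x) → (∀ x → g (f x) ≡ x) →
    EdgePreserving f → EdgePreserving g → Σ (Vtx n ↔ Vtx n) (IsAut n k)
  automorphism f g fg gf pres-f pres-g = mk↔ₛ′ f g fg gf , record
    { preserves = edgePreserving⇒adj {f} pres-f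
    ; reflects = λ x y a → subst₂ (Adj n k) (gf x) (gf y) (edgePreserving⇒adj {g} pres-g (f x) (f y) a) }

  edge-shiftV : (s : ℕ) (e : EType) (i : Fin n) (l : Fin 2) →
    ×.map (shiftV s) (shiftV s) (edge k e (i , l)) ≡ edge k e (i ⊕ s , l)
  edge-shiftV s outer i l = cong (λ j → vert false (i ⊕ s) l , vert false j (other l)) (⊕-comm i 1 s)
  edge-shiftV s spoke i l = refl
  edge-shiftV s inner i l = cong (λ j → vert true (i ⊕ s) l , vert true j (other l)) (⊕-comm i k s)

  edge-swapLayer : (e : EType) (i : Fin n) (l : Fin 2) →
    ×.map swapLayer swapLayer (edge k e (i , l)) ≡ edge k e (i , other l)
  edge-swapLayer outer i l = refl
  edge-swapLayer spoke i l = refl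
  edge-swapLayer inner i l = refl

  shiftAut : (s : ℕ) → s ≤ n → Σ (Vtx n ↔ Vtx n) (IsAut n k)
  shiftAut s s≤n =
    automorphism (shiftV s) (shiftV (n ∸ s)) shift-back-forth shift-forth-back (shifted s) (shifted (n ∸ s))
    where
    shifted : (t : ℕ) → EdgePreserving (shiftV t)
    shifted t e (i , l) = (i ⊕ t , l) , edge-shiftV t e i l
    shift-forth-back : (x : Vtx n) → shiftV (n ∸ s) (shiftV s x) ≡ x
    shift-forth-back (vert b i l) = cong (λ j → vert b j l) (⊕-inverse i s≤n)
    shift-back-forth : (x : Vtx n) → shiftV s (shiftV (n ∸ s) x) ≡ x
    shift-back-forth (vert b i l) = cong (λ j → vert b j l) (trans (⊕-comm i (n ∸ s) s) (⊕-inverse i s≤n))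

  swapLayerAut : Σ (Vtx n ↔ Vtx n) (IsAut n k)
  swapLayerAut = automorphism swapLayer swapLayer swapLayer² swapLayer² swapped swapped
    where
    swapLayer² : (x : Vtx n) → swapLayer (swapLayer x) ≡ x
    swapLayer² (vert b i l) = cong (vert b i) (other-involutive l)
    swapped : EdgePreserving swapLayer
    swapped e (i , l) = (i , other l) , edge-swapLayer e i l

  IsAut-inverse : {σ : Vtx n ↔ Vtx n} → IsAut n k σ → IsAut n k (↔-sym σ)
  IsAut-inverse {σ} aut = record
    { preserves = λ x y a → reflects (σ⁻¹ x) (σ⁻¹ y) (subst₂ (Adj n k) (sym (σσ⁻¹ x)) (sym (σσ⁻¹ y)) a)
    ; reflects = λ x y a → subst₂ (Adj n k) (σσ⁻¹ x) (σσ⁻¹ y) (preserves (σ⁻¹ x) (σ⁻¹ y) a) }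
    where
    open Inverse σ using () renaming (from to σ⁻¹; strictlyInverseˡ to σσ⁻¹)
    open IsAut aut

-- Cycles through an edge

module _ {n : ℕ} where

  infix 5 _≍ᵇ_
  _≍ᵇ_ : Vtx n × Vtx n → Vtx n × Vtx n → Bool
  (a , b) ≍ᵇ (x , y) = (a ==V x ∧ b ==V y) ∨ (a ==V y ∧ b ==V x)

  ≍ᵇ⇔≍ : (p q : Vtx n × Vtx n) → T (p ≍ᵇ q) ⇔ p ≍ q
  ≍ᵇ⇔≍ (a , b) (x , y) = mk⇔ ⇒ ⇐
    where
    ⇒ : T ((a , b) ≍ᵇ (x , y)) → (a , b) ≍ (x , y)
    ⇒ t with to T-∨ t
    ... | inj₁ t′ = inj₁ (cong₂ _,_ (to ==V⇔≡ (proj₁ (to T-∧ t′))) (to ==V⇔≡ (proj₂ (to T-∧ t′))))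
    ... | inj₂ t′ = inj₂ (cong₂ _,_ (to ==V⇔≡ (proj₁ (to T-∧ t′))) (to ==V⇔≡ (proj₂ (to T-∧ t′))))
    ⇐ : (a , b) ≍ (x , y) → T ((a , b) ≍ᵇ (x , y))
    ⇐ (inj₁ refl) = from T-∨ (inj₁ (from T-∧ (from (==V⇔≡ {x = a}) refl , from (==V⇔≡ {x = b}) refl)))
    ⇐ (inj₂ refl) = from T-∨ (inj₂ (from T-∧ (from (==V⇔≡ {x = a}) refl , from (==V⇔≡ {x = b}) refl)))

  ≍ᵇ-swapˡ : (q p : Vtx n × Vtx n) → swap q ≍ᵇ p ≡ q ≍ᵇ p
  ≍ᵇ-swapˡ (a , b) (x , y) =
    trans (cong₂ _∨_ (∧-comm (b ==V x) _) (∧-comm (b ==V y) _)) (∨-comm ((a ==V y) ∧ (b ==V x)) _)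

  ≍ᵇ-map : {τ : Vtx n → Vtx n} → (∀ {x y} → τ x ≡ τ y → x ≡ y) →
    (q p : Vtx n × Vtx n) → ×.map τ τ q ≍ᵇ ×.map τ τ p ≡ q ≍ᵇ p
  ≍ᵇ-map {τ} inj (a , b) (x , y) =
    cong₂ _∨_ (cong₂ _∧_ (==V-map a x) (==V-map b y)) (cong₂ _∧_ (==V-map a y) (==V-map b x))
    where
    ==V-map : (u v : Vtx n) → (τ u ==V τ v) ≡ (u ==V v)
    ==V-map u v = T-injective (mk⇔ (from ==V⇔≡ ∘ inj ∘ to ==V⇔≡) (from ==V⇔≡ ∘ cong τ ∘ to ==V⇔≡))

  occurrences : Vtx n × Vtx n → List (Vtx n) → ℕ
  occurrences p w = ∑ (cycEdges w) (λ q → 𝟙 (q ≍ᵇ p))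

  occurrences-⇝ : (p : Vtx n × Vtx n) {w v : List (Vtx n)} → w ⇝ v → occurrences p v ≡ occurrences p w
  occurrences-⇝ p = cycEdges-⇝ (λ es → ∑ es (λ q → 𝟙 (q ≍ᵇ p))) (∑-↭ _)
    (λ es → trans (∑-map swap _ es) (∑-cong (λ q → cong 𝟙 (≍ᵇ-swapˡ q p)) es))

  occurrences-map : {τ : Vtx n → Vtx n} → (∀ {x y} → τ x ≡ τ y → x ≡ y) →
    (p : Vtx n × Vtx n) (w : List (Vtx n)) → occurrences (×.map τ τ p) (map τ w) ≡ occurrences p w
  occurrences-map {τ} inj p w = trans (cong (λ es → ∑ es (λ q → 𝟙 (q ≍ᵇ ×.map τ τ p))) (cycEdges-map τ w))
    (trans (∑-map (×.map τ τ) _ (cycEdges w)) (∑-cong (λ q → cong 𝟙 (≍ᵇ-map inj q p)) (cycEdges w)))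

module _ {n : ℕ} (k : ℕ) .{{_ : NonZero n}} where

  private
    adjP : Vtx n × Vtx n → Bool
    adjP p = adjᵇ n k (proj₁ p) (proj₂ p)

  closedᵇ : List (Vtx n) → Bool
  closedᵇ w = allᵇ adjP (cycEdges w)

  closed-⇝ : {w v : List (Vtx n)} → w ⇝ v → closedᵇ v ≡ closedᵇ w
  closed-⇝ = cycEdges-⇝ (allᵇ adjP) (allᵇ-↭ adjP)
    (λ es → trans (allᵇ-map swap adjP es) (allᵇ-cong (λ (x , y) → adj-sym y x) es))

  closed-map : (τ : Vtx n → Vtx n) → (∀ x y → Adj n k x y → Adj n k (τ x) (τ y)) → (w : List (Vtx n)) →
    T (closedᵇ w) → T (closedᵇ (map τ w))
  closed-map τ pres w c = subst T (sym closedᵇ-map)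
    (from (T-allᵇ _ (cycEdges w)) (All.map (λ {(x , y)} → pres x y) (to (T-allᵇ adjP (cycEdges w)) c)))
    where
    closedᵇ-map : closedᵇ (map τ w) ≡ allᵇ (adjP ∘ ×.map τ τ) (cycEdges w)
    closedᵇ-map = trans (cong (allᵇ adjP) (cycEdges-map τ w)) (allᵇ-map (×.map τ τ) adjP (cycEdges w))

  record IsCycle (j : ℕ) (w : List (Vtx n)) : Set where
    field
      unique : Unique w
      closed : T (closedᵇ w)
      canonical : T (canonicalᵇ w)
      length≡ : length w ≡ j

  ∈-cycles⇒IsCycle : {j : ℕ} {w : List (Vtx n)} → w ∈ cycles n k j → IsCycle j w
  ∈-cycles⇒IsCycle {w = w} w∈ with ∈-cycles⁻ w∈
  ... | len , c with to (T-∧ {distinctᵇ w}) c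
  ...   | d , c′ with to (T-∧ {closedᵇ w}) c′
  ...     | cl , can = record { unique = to distinctᵇ⇔Unique d ; closed = cl ; canonical = can ; length≡ = len }

  canon-∈-cycles : {w : List (Vtx n)} → Unique w → T (closedᵇ w) → 3 ≤ length w →
    canon w ∈ cycles n k (length w)
  canon-∈-cycles {w} u c len = ∈-cycles⁺ (↭-length p) (from T-∧
    (from distinctᵇ⇔Unique (Unique-↭ (↭-sym p) u) , from T-∧ (subst T (sym (closed-⇝ w⇝)) c , canon-canonical u len)))
    where
    w⇝ : w ⇝ canon w
    w⇝ = canon-⇝ u
    p : canon w ↭ w
    p = ⇝⇒↭ w⇝

  cycleCount : ℕ → Vtx n × Vtx n → ℕ
  cycleCount j p = ∑ (cycles n k j) (occurrences p)

  module _ {j : ℕ} (3≤j : 3 ≤ j) where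

    canon-map-∈-cycles : {τ : Vtx n → Vtx n} → (∀ {x y} → τ x ≡ τ y → x ≡ y) →
      (∀ x y → Adj n k x y → Adj n k (τ x) (τ y)) →
      {C : List (Vtx n)} → C ∈ cycles n k j → canon (map τ C) ∈ cycles n k j
    canon-map-∈-cycles {τ} inj pres {C} C∈ = subst (λ m → canon (map τ C) ∈ cycles n k m) len≡
      (canon-∈-cycles (Unique-map⁺ inj unique) (closed-map τ pres C closed) (subst (3 ≤_) (sym len≡) 3≤j))
      where
      open IsCycle (∈-cycles⇒IsCycle {j = j} C∈)
      len≡ : length (map τ C) ≡ j
      len≡ = trans (length-map τ C) length≡

    canon-map-inverse : {τ τ⁻ : Vtx n → Vtx n} → (∀ x → τ⁻ (τ x) ≡ x) →
      {C : List (Vtx n)} → C ∈ cycles n k j → canon (map τ⁻ (canon (map τ C))) ≡ C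
    canon-map-inverse {τ} {τ⁻} inv {C} C∈ =
      trans (canon-⇝-invariant unique (subst (3 ≤_) (sym length≡) 3≤j) C⇝) (canon-fixed unique canonical)
      where
      open IsCycle (∈-cycles⇒IsCycle {j = j} C∈)
      τ-injective : ∀ {x y} → τ x ≡ τ y → x ≡ y
      τ-injective {x} {y} eq = trans (sym (inv x)) (trans (cong τ⁻ eq) (inv y))
      C⇝ : C ⇝ map τ⁻ (canon (map τ C))
      C⇝ = subst (_⇝ map τ⁻ (canon (map τ C))) (map-inverse inv C)
        (⇝-map τ⁻ (canon-⇝ (Unique-map⁺ τ-injective unique)))

    -- σ permutes the j-cycles by C ↦ canon (map σ C), and an edge p lies on C as often as σ p lies on its image.
    cycleCount-aut : (σ : Vtx n ↔ Vtx n) → IsAut n k σ → (p : Vtx n × Vtx n) →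
      cycleCount j (×.map (Inverse.to σ) (Inverse.to σ) p) ≡ cycleCount j p
    cycleCount-aut σ aut p = begin
      ∑ Cs (occurrences σp)                          ≡⟨ ∑-↭ (occurrences σp) (↭-sym relabel-↭) ⟩
      ∑ (map relabel Cs) (occurrences σp)            ≡⟨ ∑-map relabel (occurrences σp) Cs ⟩
      ∑ Cs (occurrences σp ∘ relabel)                ≡⟨ ∑-cong-∈ Cs relabel-occurrences ⟩
      ∑ Cs (occurrences p)                           ∎
      where
      open ≡-Reasoning
      open Inverse σ using () renaming (to to τ; from to τ⁻¹; strictlyInverseˡ to ττ⁻¹; strictlyInverseʳ to τ⁻¹τ)
      Cs : List (List (Vtx n))
      Cs = cycles n k j
      σp : Vtx n × Vtx n
      σp = ×.map τ τ p
      relabel : List (Vtx n) → List (Vtx n)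
      relabel C = canon (map τ C)
      τ-injective : ∀ {x y} → τ x ≡ τ y → x ≡ y
      τ-injective {x} {y} eq = trans (sym (τ⁻¹τ x)) (trans (cong τ⁻¹ eq) (τ⁻¹τ y))
      τ⁻¹-injective : ∀ {x y} → τ⁻¹ x ≡ τ⁻¹ y → x ≡ y
      τ⁻¹-injective {x} {y} eq = trans (sym (ττ⁻¹ x)) (trans (cong τ eq) (ττ⁻¹ y))
      relabel-↭ : map relabel Cs ↭ Cs
      relabel-↭ = map-↭-bijection relabel (canon ∘ map τ⁻¹) (cycles-unique {j = j})
        (canon-map-∈-cycles τ-injective (IsAut.preserves aut))
        (canon-map-∈-cycles τ⁻¹-injective (IsAut.preserves (IsAut-inverse aut)))
        (canon-map-inverse τ⁻¹τ)
        (canon-map-inverse ττ⁻¹)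
      relabel-occurrences : {C : List (Vtx n)} → C ∈ Cs → occurrences σp (relabel C) ≡ occurrences p C
      relabel-occurrences {C} C∈ = trans
        (occurrences-⇝ σp (canon-⇝ (Unique-map⁺ τ-injective (IsCycle.unique (∈-cycles⇒IsCycle {j = j} C∈)))))
        (occurrences-map τ-injective p C)

  cycleCount-swap : (j : ℕ) (p : Vtx n × Vtx n) → cycleCount j (swap p) ≡ cycleCount j p
  cycleCount-swap j (x , y) =
    ∑-cong (λ C → ∑-cong (λ (a , b) → cong 𝟙 (∨-comm ((a ==V y) ∧ (b ==V x)) _)) (cycEdges C)) (cycles n k j)

-- Counting cycles by edge type

module _ {n k : ℕ} .{{_ : NonZero n}} where

  indices : List (Fin n × Fin 2)
  indices = cartesianProduct (allFin n) (allFin 2)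

  indices-unique : Unique indices
  indices-unique = cartesianProduct⁺ (allFin⁺ n) (allFin⁺ 2)

  ∈-indices : (ι : Fin n × Fin 2) → ι ∈ indices
  ∈-indices (i , l) = ∈-cartesianProduct⁺ (∈-allFin i) (∈-allFin l)

  edge-index-count : 1 ≤ k → 2 * k < n → (e : EType) (p : Vtx n × Vtx n) →
    ∑ indices (λ ι → 𝟙 (p ≍ᵇ edge k e ι)) ≡ 𝟙 (isEdgeOfType n k e (proj₁ p) (proj₂ p))
  edge-index-count 1≤k 2k<n e p with isEdgeOfType n k e (proj₁ p) (proj₂ p) in p-edge
  ... | true with isEdge⇒edge e p (subst T (sym p-edge) _)
  ...   | ι₀ , p≍ι₀ = ∑-𝟙-unique (λ ι → p ≍ᵇ edge k e ι) indices-unique (∈-indices ι₀)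
    (from (≍ᵇ⇔≍ p _) p≍ι₀) (λ {ι} t → edge-injective 1≤k 2k<n e (≍-trans (≍-sym (to (≍ᵇ⇔≍ p (edge k e ι)) t)) p≍ι₀))
  edge-index-count 1≤k 2k<n e p | false = ∑-𝟙-none (λ ι → p ≍ᵇ edge k e ι) indices
    λ {ι} _ t → subst T p-edge (isEdge-≍ e (to (≍ᵇ⇔≍ p (edge k e ι)) t) (edge-isEdge e ι))

  countType≡∑-occurrences : 1 ≤ k → 2 * k < n → (e : EType) (C : List (Vtx n)) →
    countType n k e C ≡ ∑ indices (λ ι → occurrences (edge k e ι) C)
  countType≡∑-occurrences 1≤k 2k<n e C = begin
    countType n k e C
      ≡⟨ length-filter-T? (λ p → isEdgeOfType n k e (proj₁ p) (proj₂ p)) (cycEdges C) ⟩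
    ∑ (cycEdges C) (λ p → 𝟙 (isEdgeOfType n k e (proj₁ p) (proj₂ p)))
      ≡⟨ ∑-cong (edge-index-count 1≤k 2k<n e) (cycEdges C) ⟨
    ∑ (cycEdges C) (λ p → ∑ indices (λ ι → 𝟙 (p ≍ᵇ edge k e ι)))
      ≡⟨ ∑-comm (λ p ι → 𝟙 (p ≍ᵇ edge k e ι)) (cycEdges C) indices ⟩
    ∑ indices (λ ι → occurrences (edge k e ι) C)
      ∎
    where open ≡-Reasoning

  sumType≡∑-cycleCount : 1 ≤ k → 2 * k < n → (e : EType) (j : ℕ) →
    sumType n k e j ≡ ∑ indices (λ ι → cycleCount k j (edge k e ι))
  sumType≡∑-cycleCount 1≤k 2k<n e j =
    trans (∑-cong (countType≡∑-occurrences 1≤k 2k<n e) (cycles n k j))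
          (∑-comm (λ C ι → occurrences (edge k e ι) C) (cycles n k j) indices)

  ring-endpoints : (b : Bool) (x y : Vtx n) → T (isEdgeOfType n k (ring b) x y) → isInner x ≡ b × isInner y ≡ b
  ring-endpoints false (vert false _ _) (vert false _ _) _ = refl , refl
  ring-endpoints true (vert true _ _) (vert true _ _) _ = refl , refl

  ring-edge-at : (z : Vtx n) → ∃ λ z′ → T (isEdgeOfType n k (ring (isInner z)) z z′)
  ring-edge-at (vert false i l) = proj₂ (edge k outer (i , l)) , edge-isEdge {k = k} outer (i , l)
  ring-edge-at (vert true i l) = proj₂ (edge k inner (i , l)) , edge-isEdge {k = k} inner (i , l)

  spoke-endpoints : (x y : Vtx n) → T (isEdgeOfType n k spoke x y) → (b : Bool) → isInner x ≡ b ⊎ isInner y ≡ b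
  spoke-endpoints (vert false _ _) (vert true _ _) _ false = inj₁ refl
  spoke-endpoints (vert false _ _) (vert true _ _) _ true = inj₂ refl
  spoke-endpoints (vert true _ _) (vert false _ _) _ false = inj₂ refl
  spoke-endpoints (vert true _ _) (vert false _ _) _ true = inj₁ refl

  module _ {j : ℕ} (3≤j : 3 ≤ j) where

    typeCount : EType → ℕ
    typeCount e = cycleCount k j (edge k e (origin , 0F))

    cycleCount-edge : (e : EType) (ι : Fin n × Fin 2) → cycleCount k j (edge k e ι) ≡ typeCount e
    cycleCount-edge e (i , l) = trans shifted (layer l)
      where
      σ : Σ (Vtx n ↔ Vtx n) (IsAut n k)
      σ = shiftAut (toℕ i) (<⇒≤ (toℕ<n i))
      shifted : cycleCount k j (edge k e (i , l)) ≡ cycleCount k j (edge k e (origin , l))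
      shifted = begin
        cycleCount k j (edge k e (i , l))
          ≡⟨ cong (λ i′ → cycleCount k j (edge k e (i′ , l))) (origin-⊕ i) ⟨
        cycleCount k j (edge k e (origin ⊕ toℕ i , l))
          ≡⟨ cong (cycleCount k j) (edge-shiftV (toℕ i) e origin l) ⟨
        cycleCount k j (×.map (shiftV (toℕ i)) (shiftV (toℕ i)) (edge k e (origin , l)))
          ≡⟨ cycleCount-aut k 3≤j (proj₁ σ) (proj₂ σ) (edge k e (origin , l)) ⟩
        cycleCount k j (edge k e (origin , l))
          ∎
        where open ≡-Reasoning
      layer : (l : Fin 2) → cycleCount k j (edge k e (origin , l)) ≡ typeCount e
      layer 0F = refl
      layer (sucF 0F) = trans (cong (cycleCount k j) (sym (edge-swapLayer {k = k} e origin 0F)))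
        (cycleCount-aut k 3≤j (proj₁ (swapLayerAut {k = k})) (proj₂ swapLayerAut) (edge k e (origin , 0F)))

    cycleCount-isEdge : (e : EType) (x y : Vtx n) → T (isEdgeOfType n k e x y) → cycleCount k j (x , y) ≡ typeCount e
    cycleCount-isEdge e x y h with isEdge⇒edge e (x , y) h
    ... | ι , inj₁ eq = trans (cong (cycleCount k j) eq) (cycleCount-edge e ι)
    ... | ι , inj₂ eq = trans (cong (cycleCount k j) eq) (trans (cycleCount-swap k j (edge k e ι)) (cycleCount-edge e ι))

    Distinguished : EType → Set
    Distinguished e = ∀ e′ → typeCount e′ ≡ typeCount e → e′ ≡ e

    module _ (σ : Vtx n ↔ Vtx n) (aut : IsAut n k σ) where

      private
        τ : Vtx n → Vtx n
        τ = Inverse.to σ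

      image-edge-type : (e : EType) (x y : Vtx n) → T (isEdgeOfType n k e x y) →
        ∃ λ e′ → T (isEdgeOfType n k e′ (τ x) (τ y)) × typeCount e′ ≡ typeCount e
      image-edge-type e x y h with adj-type (τ x) (τ y) (IsAut.preserves aut x y (adj-intro e x y h))
      ... | e′ , h′ = e′ , h′ , same-count
        where
        open ≡-Reasoning
        same-count : typeCount e′ ≡ typeCount e
        same-count = begin
          typeCount e′               ≡⟨ cycleCount-isEdge e′ _ _ h′ ⟨
          cycleCount k j (τ x , τ y) ≡⟨ cycleCount-aut k 3≤j σ aut (x , y) ⟩
          cycleCount k j (x , y)     ≡⟨ cycleCount-isEdge e x y h ⟩
          typeCount e                ∎

      distinguished-preserved : (e : EType) → Distinguished e →
        (x y : Vtx n) → T (isEdgeOfType n k e x y) → T (isEdgeOfType n k e (τ x) (τ y))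
      distinguished-preserved e dist x y h with image-edge-type e x y h
      ... | e′ , h′ , eq with dist e′ eq
      ...   | refl = h′

      side-preserved : (b : Bool) → Distinguished (ring b) → (z : Vtx n) → isInner z ≡ b → isInner (τ z) ≡ b
      side-preserved _ dist z refl with ring-edge-at z
      ... | z′ , h = proj₁ (ring-endpoints (isInner z) _ _ (distinguished-preserved (ring (isInner z)) dist z z′ h))

      spoke-image-not-ring : (b : Bool) → Distinguished (ring b) → (x y : Vtx n) → Spoke n k x y →
        (b′ : Bool) → T (isEdgeOfType n k (ring b′) (τ x) (τ y)) → typeCount (ring b′) ≢ typeCount spoke
      spoke-image-not-ring b dist x y s b′ h′ eq =
        spoke≢ring b (dist spoke (sym (subst (λ c → typeCount (ring c) ≡ typeCount spoke) b′≡b eq)))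
        where
        b′≡b : b′ ≡ b
        b′≡b with spoke-endpoints x y s b
        ... | inj₁ x-side = trans (sym (proj₁ (ring-endpoints b′ _ _ h′))) (side-preserved b dist x x-side)
        ... | inj₂ y-side = trans (sym (proj₂ (ring-endpoints b′ _ _ h′))) (side-preserved b dist y y-side)

      distinguished-ring⇒spokes-preserved : (b : Bool) → Distinguished (ring b) →
        (x y : Vtx n) → Spoke n k x y → Spoke n k (τ x) (τ y)
      distinguished-ring⇒spokes-preserved b dist x y s with image-edge-type spoke x y s
      ... | spoke , h′ , _ = h′
      ... | outer , h′ , eq = ⊥-elim (spoke-image-not-ring b dist x y s false h′ eq)
      ... | inner , h′ , eq = ⊥-elim (spoke-image-not-ring b dist x y s true h′ eq)

      spokes-preserved : ¬ (typeCount spoke ≡ typeCount outer × typeCount spoke ≡ typeCount inner) →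
        (x y : Vtx n) → Spoke n k x y → Spoke n k (τ x) (τ y)
      spokes-preserved ¬equal with typeCount spoke ≟ typeCount outer | typeCount spoke ≟ typeCount inner
      ... | yes s≡o | yes s≡i = ⊥-elim (¬equal (s≡o , s≡i))
      ... | no s≢o | no s≢i = distinguished-preserved spoke λ
        { outer eq → ⊥-elim (s≢o (sym eq)) ; spoke _ → refl ; inner eq → ⊥-elim (s≢i (sym eq)) }
      ... | yes s≡o | no s≢i = distinguished-ring⇒spokes-preserved true λ
        { outer eq → ⊥-elim (s≢i (trans s≡o eq)) ; spoke eq → ⊥-elim (s≢i eq) ; inner _ → refl }
      ... | no s≢o | yes s≡i = distinguished-ring⇒spokes-preserved false λ
        { outer _ → refl ; spoke eq → ⊥-elim (s≢o eq) ; inner eq → ⊥-elim (s≢o (trans s≡i eq)) }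

    A≢B⇒equal-counts : A≢B n k → typeCount spoke ≡ typeCount outer × typeCount spoke ≡ typeCount inner
    A≢B⇒equal-counts (σ , aut , σ∉B)
      with (typeCount spoke ≟ typeCount outer) ×-dec (typeCount spoke ≟ typeCount inner)
    ... | yes equal = equal
    ... | no ¬equal = ⊥-elim (σ∉B (record
      { image⊆ = spokes-preserved σ aut ¬equal
      ; ⊆image = λ x y s → Inverse.from σ x , Inverse.from σ y ,
          spokes-preserved (↔-sym σ) (IsAut-inverse aut) ¬equal x y s ,
          Inverse.strictlyInverseˡ σ x , Inverse.strictlyInverseˡ σ y }))

    sumType≡∑-typeCount : 1 ≤ k → 2 * k < n → (e : EType) → sumType n k e j ≡ ∑ indices (λ _ → typeCount e)
    sumType≡∑-typeCount 1≤k 2k<n e = trans (sumType≡∑-cycleCount 1≤k 2k<n e j) (∑-cong (cycleCount-edge e) indices)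

    sumType-cong : 1 ≤ k → 2 * k < n → {e e′ : EType} → typeCount e ≡ typeCount e′ →
      sumType n k e j ≡ sumType n k e′ j
    sumType-cong 1≤k 2k<n {e} {e′} eq = begin
      sumType n k e j                ≡⟨ sumType≡∑-typeCount 1≤k 2k<n e ⟩
      ∑ indices (λ _ → typeCount e)  ≡⟨ cong (λ c → ∑ indices (λ _ → c)) eq ⟩
      ∑ indices (λ _ → typeCount e′) ≡⟨ sumType≡∑-typeCount 1≤k 2k<n e′ ⟨
      sumType n k e′ j               ∎
      where open ≡-Reasoning

lemma5p7 : (n k : ℕ) .{{_ : NonZero n}} → 1 ≤ k → 2 * k < n →
    A≢B n k →
    (j : ℕ) → 3 ≤ j → j ≤ 4 * n →
    (R n k j ≡ S n k j) × (S n k j ≡ T' n k j)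
lemma5p7 n k 1≤k 2k<n a≢b j 3≤j _ with A≢B⇒equal-counts {k = k} {j = j} 3≤j a≢b
... | spoke≡outer , spoke≡inner =
  sumType-cong {k = k} {j = j} 3≤j 1≤k 2k<n {outer} {spoke} (sym spoke≡outer) ,
  sumType-cong {k = k} {j = j} 3≤j 1≤k 2k<n {spoke} {inner} spoke≡inner
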